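{- Let $q\ge 2$ be an integer, let $h_q$ be the morphism on $\{a,b\}^*$ given by $h_q(a)=a^qb$, $h_q(b)=b$, and let $\mathbf z_q=\lim_{n\to\infty}h_q^n(a)$ be its infinite fixed point starting with $a$. Then for every $n\ge 0$ the number of distinct factors of $\mathbf z_q$ of length $n$ equals $$\sum_{0\le i\le n}\min(q^i,\,n-i+1).$$
   Context: A factor of an infinite word is a finite contiguous block of it. -}

module Defs where

open import Data.Nat using (ℕ; zero; suc; _+_; _∸_; _^_; _⊓_)
open import Data.List using (List; []; _∷_; _++_; concatMap; replicate; map; upTo; length)
open import Data.Nat.ListAction using (sum)
open import Data.List.Membership.Propositional using (_∈_)
open import Data.List.Relation.Unary.Unique.Propositional using (Unique)
open import Data.Vec using (Vec; tabulate)
open import Data.Fin using (toℕ)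
open import Data.Product using (Σ; ∃; _×_)
open import Relation.Binary.PropositionalEquality using (_≡_)

data Letter : Set where
  a b : Letter

hLetter : ℕ → Letter → List Letter
hLetter q a = replicate q a ++ (b ∷ [])
hLetter q b = b ∷ []

h : ℕ → List Letter → List Letter
h q w = concatMap (hLetter q) w

hIter : ℕ → ℕ → List Letter
hIter q zero    = a ∷ []
hIter q (suc n) = h q (hIter q n)

-- i-th letter of a finite word (default b if out of range; never used
-- out of range below)
nth : List Letter → ℕ → Letter
nth []       _       = b
nth (x ∷ w)  zero    = x
nth (x ∷ w)  (suc i) = nth w i

-- The infinite fixed point z_q = lim h_q^n(a) (for q ≥ 1).
-- Each h_q^n(a) is a prefix of h_q^(n+1)(a) and |h_q^n(a)| ≥ n+1,
-- so the i-th letter of z_q is the i-th letter of h_q^(i+1)(a).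
z : ℕ → ℕ → Letter
z q i = nth (hIter q (suc i)) i

factorAt : ℕ → (n i : ℕ) → Vec Letter n
factorAt q n i = tabulate (λ k → z q (i + toℕ k))

IsFactor : ℕ → {n : ℕ} → Vec Letter n → Set
IsFactor q {n} u = ∃ λ i → factorAt q n i ≡ u

FactorCount : ℕ → ℕ → ℕ → Set
FactorCount q n N =
  Σ (List (Vec Letter n)) λ L →
    Unique L × length L ≡ N × (∀ (u : Vec Letter n) → (u ∈ L → IsFactor q u) × (IsFactor q u → u ∈ L))

formula : ℕ → ℕ → ℕ
formula q n = sum (map (λ i → (q ^ i) ⊓ (n ∸ i + 1)) (upTo (suc n)))

-- Since h_q^(K+1)(a) = h_q^K(a)^q b, the fixed point z_q is the ruler-like word
-- a b^ν(1) a b^ν(2) a b^ν(3) ⋯, with ν the q-adic valuation.  Over {a, b} the factor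
-- counts satisfy p(n + 1) = p(n) + s(n), where s(n) is the number of right-special factors
-- of length n.  These are, one for each level t ≤ n with n − t + 1 ≤ q^(t+1), the factors
-- of length n ending after t of the t + 1 b's that follow the last a of h^(t+1)(a).  A
-- right-special factor ending in a b^t whose part before that a is longer would contain
-- the word from the last a of h^t(a) to the last a of h^(t+1)(a); but that word reappears
-- only where the following block is longer than t, since the valuations of the q numbers
-- x + 1 + d q^t (d < q) cannot all equal t.  The sum Σ_{i ≤ n} min(q^i, n − i + 1)
-- satisfies the same recurrence.
module Submission where

open import Defs
open import Data.Nat using (ℕ; zero; suc; _+_; _*_; _∸_; _^_; _⊓_; _<_; _≤_; _<?_; _≤?_; s≤s; z≤n; >-nonZero)
open import Data.Nat.Properties
open import Data.Nat.Divisibility using (_∣_; divides; _∣?_; ∣-refl; ∣-trans; ∣⇒≤; n∣m*n; *-monoʳ-∣; *-cancelˡ-∣; *-cancelʳ-∣; ∣m∣n⇒∣m+n; ∣m+n∣m⇒∣n)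
open import Data.Nat.Tactic.RingSolver using (solve-∀)
open import Data.Nat.DivMod using (_/_; _%_; m≡m%n+[m/n]*n; m%n<n)
open import Data.List using (List; []; _∷_; _++_; map; length; filter; concatMap; replicate; upTo; applyUpTo)
open import Data.Nat.ListAction using (sum)
open import Data.List.Properties using (length-map; length-++; length-replicate; ++-assoc; ++-identityʳ; concatMap-++; map-applyUpTo; map-cong)
open import Data.List.Membership.Propositional using (_∈_; find; mapWith∈)
open import Data.List.Membership.Propositional.Properties
  using (∈-map⁺; ∈-map⁻; mapWith∈≗map; ∈-++⁺ˡ; ∈-++⁺ʳ; ∈-filter⁺; ∈-filter⁻; ∈-concatMap⁺; ∈-concatMap⁻; ∈-upTo⁺; ∈-upTo⁻)
import Data.List.Membership.DecPropositional as DecMembership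
open import Data.List.Membership.Propositional.Properties.WithK using (unique∧set⇒bag)
open import Data.List.Relation.Unary.Any using (here; there)
import Data.List.Relation.Unary.Any as Any
open import Data.List.Relation.Unary.All using (All; []; _∷_)
import Data.List.Relation.Unary.All as All
import Data.List.Relation.Unary.All.Properties as All
open import Data.List.Relation.Unary.AllPairs using (AllPairs; []; _∷_)
import Data.List.Relation.Unary.AllPairs as AllPairs
import Data.List.Relation.Unary.AllPairs.Properties as AllPairs
open import Data.List.Relation.Unary.Unique.Propositional using (Unique)
open import Data.List.Relation.Binary.BagAndSetEquality using (∼bag⇒↭)
open import Data.List.Relation.Binary.Permutation.Propositional.Properties using (↭-length)
open import Data.Vec using (Vec; tabulate; lookup)
open import Data.Vec.Properties using (lookup∘tabulate; tabulate-cong; ≡-dec)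
open import Data.Fin using (toℕ; fromℕ<)
open import Data.Fin.Properties using (toℕ-fromℕ<; toℕ<n)
open import Data.Product using (∃; _×_; _,_; proj₁; proj₂)
open import Data.Sum using (_⊎_; inj₁; inj₂)
open import Data.Empty using (⊥-elim)
open import Function.Base using (_∘_)
open import Function.Bundles using (mk⇔)
open import Relation.Nullary using (¬_; Dec; yes; no; ¬?)
open import Relation.Binary.Definitions using (DecidableEquality; tri<; tri≈; tri>)
open import Relation.Binary.PropositionalEquality using (_≡_; _≢_; refl; sym; trans; cong; cong₂; subst; subst₂; module ≡-Reasoning)

_≟ᴸ_ : DecidableEquality Letter
a ≟ᴸ a = yes refl
a ≟ᴸ b = no λ ()
b ≟ᴸ a = no λ ()
b ≟ᴸ b = yes refl

≢a⇒≡b : ∀ {x} → x ≢ a → x ≡ b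
≢a⇒≡b {a} x≢a = ⊥-elim (x≢a refl)
≢a⇒≡b {b} _   = refl

≢b⇒≡a : ∀ {x} → x ≢ b → x ≡ a
≢b⇒≡a {a} _   = refl
≢b⇒≡a {b} x≢b = ⊥-elim (x≢b refl)

nth-++ˡ : ∀ xs ys i → i < length xs → nth (xs ++ ys) i ≡ nth xs i
nth-++ˡ (x ∷ xs) ys zero    _         = refl
nth-++ˡ (x ∷ xs) ys (suc i) (s≤s i<n) = nth-++ˡ xs ys i i<n

nth-++ʳ : ∀ xs ys i → nth (xs ++ ys) (length xs + i) ≡ nth ys i
nth-++ʳ []       ys i = refl
nth-++ʳ (x ∷ xs) ys i = nth-++ʳ xs ys i

case-< : ∀ {P : ℕ → Set} {k n} → k < suc n → (k < n → P k) → P n → P k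
case-< k<1+n below at with m≤n⇒m<n∨m≡n (≤-pred k<1+n)
... | inj₁ k<n  = below k<n
... | inj₂ refl = at

≤-+-cases : ∀ L t d → d ≤ L + t → d ≤ L ⊎ ∃ λ k → k < t × d ≡ L + suc k
≤-+-cases L t d d≤L+t with d ≤? L
... | yes d≤L = inj₁ d≤L
... | no d≰L  = inj₂ (d ∸ suc L , k<t , sym (trans (+-suc L (d ∸ suc L)) d≡))
  where
    d≡ : suc L + (d ∸ suc L) ≡ d
    d≡ = m+[n∸m]≡n (≰⇒> d≰L)
    k<t : d ∸ suc L < t
    k<t = +-cancelˡ-< (suc L) (d ∸ suc L) t (subst (_< suc L + t) (sym d≡) (s≤s d≤L+t))

map-mapWith∈ : ∀ {A B C : Set} (xs : List A) (f : ∀ {x} → x ∈ xs → B) (g : B → C) →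
  map g (mapWith∈ xs f) ≡ mapWith∈ xs (g ∘ f)
map-mapWith∈ []       f g = refl
map-mapWith∈ (x ∷ xs) f g = cong (g (f (here refl)) ∷_) (map-mapWith∈ xs (f ∘ there) g)

AllPairs-restrict : ∀ {A : Set} {P : A → Set} {R S : A → A → Set} {xs} →
  (∀ {x y} → P x → P y → R x y → S x y) → All P xs → AllPairs R xs → AllPairs S xs
AllPairs-restrict R⇒S []         []           = []
AllPairs-restrict R⇒S (px ∷ pxs) (Rx ∷ Rxs) =
  All.zipWith (λ (py , Rxy) → R⇒S px py Rxy) (pxs , Rx) ∷ AllPairs-restrict R⇒S pxs Rxs

length-filter-+-length-filter-¬ : ∀ {A : Set} {P : A → Set} (P? : ∀ x → Dec (P x)) xs →
  length (filter P? xs) + length (filter (λ x → ¬? (P? x)) xs) ≡ length xs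
length-filter-+-length-filter-¬ P? [] = refl
length-filter-+-length-filter-¬ P? (x ∷ xs) with P? x
... | yes _ = cong suc (length-filter-+-length-filter-¬ P? xs)
... | no _  = trans (+-suc _ _) (cong suc (length-filter-+-length-filter-¬ P? xs))

𝟙 : ∀ {A : Set} → Dec A → ℕ
𝟙 (yes _) = 1
𝟙 (no _)  = 0

𝟙-yes : ∀ {A : Set} (d : Dec A) → A → 𝟙 d ≡ 1
𝟙-yes (yes _) _ = refl
𝟙-yes (no ¬x) x = ⊥-elim (¬x x)

𝟙-no : ∀ {A : Set} (d : Dec A) → ¬ A → 𝟙 d ≡ 0
𝟙-no (yes x) ¬x = ⊥-elim (¬x x)
𝟙-no (no _)  _  = refl

⊓-suc : ∀ m n → m ⊓ suc n ≡ m ⊓ n + 𝟙 (suc n ≤? m)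
⊓-suc m n with suc n ≤? m
... | yes n<m = trans (m≥n⇒m⊓n≡n n<m) (trans (cong suc (sym (m≥n⇒m⊓n≡n (<⇒≤ n<m)))) (+-comm 1 _))
... | no n≮m  = trans (m≤n⇒m⊓n≡m (<⇒≤ (≰⇒> n≮m)))
                  (trans (sym (m≤n⇒m⊓n≡m (≤-pred (≰⇒> n≮m)))) (sym (+-identityʳ _)))

∑< : ℕ → (ℕ → ℕ) → ℕ
∑< n f = sum (applyUpTo f n)

∑<-suc : ∀ n f → ∑< (suc n) f ≡ ∑< n f + f n
∑<-suc zero    f = +-comm (f 0) 0
∑<-suc (suc n) f = trans (cong (f 0 +_) (∑<-suc n (f ∘ suc))) (sym (+-assoc (f 0) _ _))

∑<-cong : ∀ n {f g} → (∀ i → i < n → f i ≡ g i) → ∑< n f ≡ ∑< n g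
∑<-cong zero    f≡g = refl
∑<-cong (suc n) f≡g = cong₂ _+_ (f≡g 0 (s≤s z≤n)) (∑<-cong n λ i i<n → f≡g (suc i) (s≤s i<n))

∑<-+ : ∀ n f g → ∑< n (λ i → f i + g i) ≡ ∑< n f + ∑< n g
∑<-+ zero    f g = refl
∑<-+ (suc n) f g = trans (cong (f 0 + g 0 +_) (∑<-+ n (f ∘ suc) (g ∘ suc))) (+-+-comm (f 0) (g 0) _ _)
  where
    +-+-comm : ∀ w x y z → w + x + (y + z) ≡ w + y + (x + z)
    +-+-comm = solve-∀

length-filter-applyUpTo : ∀ {P : ℕ → Set} (P? : ∀ x → Dec (P x)) n f →
  length (filter P? (applyUpTo f n)) ≡ ∑< n (λ i → 𝟙 (P? (f i)))
length-filter-applyUpTo P? zero    f = refl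
length-filter-applyUpTo P? (suc n) f with P? (f 0)
... | yes _ = cong suc (length-filter-applyUpTo P? n (f ∘ suc))
... | no _  = length-filter-applyUpTo P? n (f ∘ suc)

module FactorsOf (Z : ℕ → Letter) where

  factor : (n i : ℕ) → Vec Letter n
  factor n i = tabulate (λ k → Z (i + toℕ k))

  Agree : (n i j : ℕ) → Set
  Agree n i j = ∀ k → k < n → Z (i + k) ≡ Z (j + k)

  Distinct : (n i j : ℕ) → Set
  Distinct n i j = factor n i ≢ factor n j

  factor-≡⇒Agree : ∀ {n i j} → factor n i ≡ factor n j → Agree n i j
  factor-≡⇒Agree {n} {i} {j} eq k k<n = begin
    Z (i + k)                           ≡⟨ cong (λ l → Z (i + l)) (sym (toℕ-fromℕ< k<n)) ⟩
    Z (i + toℕ (fromℕ< k<n))            ≡⟨ sym (lookup∘tabulate _ (fromℕ< k<n)) ⟩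
    lookup (factor n i) (fromℕ< k<n)    ≡⟨ cong (λ v → lookup v (fromℕ< k<n)) eq ⟩
    lookup (factor n j) (fromℕ< k<n)    ≡⟨ lookup∘tabulate _ (fromℕ< k<n) ⟩
    Z (j + toℕ (fromℕ< k<n))            ≡⟨ cong (λ l → Z (j + l)) (toℕ-fromℕ< k<n) ⟩
    Z (j + k)                           ∎
    where open ≡-Reasoning

  Agree⇒factor-≡ : ∀ {n i j} → Agree n i j → factor n i ≡ factor n j
  Agree⇒factor-≡ agree = tabulate-cong (λ k → agree (toℕ k) (toℕ<n k))

  Agree-sym : ∀ {n i j} → Agree n i j → Agree n j i
  Agree-sym agree k k<n = sym (agree k k<n)

  Agree-trans : ∀ {n i j l} → Agree n i j → Agree n j l → Agree n i l
  Agree-trans ij jl k k<n = trans (ij k k<n) (jl k k<n)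

  Agree-init : ∀ {n i j} → Agree (suc n) i j → Agree n i j
  Agree-init agree k k<n = agree k (m<n⇒m<1+n k<n)

  Agree-last : ∀ {n i j} → Agree (suc n) i j → Z (i + n) ≡ Z (j + n)
  Agree-last {n} agree = agree n (n<1+n n)

  Agree-snoc : ∀ {n i j} → Agree n i j → Z (i + n) ≡ Z (j + n) → Agree (suc n) i j
  Agree-snoc agree last k k<1+n = case-< k<1+n (agree k) last

  Distinct-extend : ∀ {n i i′ j j′} → Agree n i i′ → Agree n j j′ → Distinct n i′ j′ → Distinct (suc n) i j
  Distinct-extend ii′ jj′ i′≢j′ eq =
    i′≢j′ (Agree⇒factor-≡ (Agree-trans (Agree-sym ii′) (Agree-trans (Agree-init (factor-≡⇒Agree eq)) jj′)))

  BRun : (i m t : ℕ) → Set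
  BRun i m t = ∀ k → k < t → Z (i + (suc m + k)) ≡ b

  data LastA (n i : ℕ) : Set where
    no-a   : (∀ k → k < n → Z (i + k) ≡ b) → LastA n i
    last-a : ∀ m t → n ≡ suc m + t → Z (i + m) ≡ a → BRun i m t → LastA n i

  lastA : ∀ n i → LastA n i
  lastA zero    i = no-a λ _ ()
  lastA (suc n) i with lastA n i | Z (i + n) ≟ᴸ b
  ... | _ | no Z≢b = last-a n 0 (sym (+-identityʳ (suc n))) (≢b⇒≡a Z≢b) λ _ ()
  ... | no-a all-b | yes Z≡b = no-a λ k k<1+n → case-< k<1+n (all-b k) Z≡b
  ... | last-a m t n≡ Z≡a run | yes Z≡b = last-a m (suc t) (trans (cong suc n≡) (sym (+-suc (suc m) t))) Z≡a
        λ k k<1+t → case-< k<1+t (run k) (subst (λ x → Z (i + x) ≡ b) n≡ Z≡b)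

  record RightSpecial (n : ℕ) : Set where
    field
      bpos apos : ℕ
      b-follows : Z (bpos + n) ≡ b
      a-follows : Z (apos + n) ≡ a
      agree : Agree n apos bpos

  open RightSpecial

  words : ∀ {n} → List (RightSpecial n) → List (Vec Letter n)
  words {n} = map (λ w → factor n (bpos w))

  occurrences : ∀ {n} → RightSpecial n → List ℕ
  occurrences w = bpos w ∷ apos w ∷ []

  -- Over a binary alphabet, each factor of length n has one extension of length n + 1,
  -- except the right-special ones, which have two.
  module Counting
    (special : (n : ℕ) → List (RightSpecial n))
    (special-distinct : ∀ n → Unique (words (special n)))
    (special-complete : ∀ n i j → factor n i ≡ factor n j → Z (i + n) ≢ Z (j + n) → factor n i ∈ words (special n))
    where

    isSpecial? : ∀ n i → Dec (factor n i ∈ words (special n))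
    isSpecial? n i = DecMembership._∈?_ (≡-dec _≟ᴸ_) (factor n i) (words (special n))

    notSpecial? : ∀ n i → Dec (¬ factor n i ∈ words (special n))
    notSpecial? n i = ¬? (isSpecial? n i)

    survivors : ℕ → List ℕ → List ℕ
    survivors n = filter (notSpecial? n)

    branches : ℕ → List ℕ
    branches n = concatMap occurrences (special n)

    -- one occurrence of each factor of length n
    reps : ℕ → List ℕ
    reps zero    = 0 ∷ []
    reps (suc n) = survivors n (reps n) ++ branches n

    specialTotal : ℕ → ℕ
    specialTotal zero    = 0
    specialTotal (suc n) = specialTotal n + length (special n)

    ∈-branches⁺ : ∀ {n w i} → w ∈ special n → i ∈ occurrences w → i ∈ branches n
    ∈-branches⁺ w∈ i∈ = ∈-concatMap⁺ occurrences (Any.map (λ { refl → i∈ }) w∈)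

    ∈-branches⁻ : ∀ {n i} → i ∈ branches n → ∃ λ w → w ∈ special n × Agree n i (bpos w)
    ∈-branches⁻ {n} i∈ with find (∈-concatMap⁻ occurrences {xs = special n} i∈)
    ... | w , w∈ , here refl         = w , w∈ , λ _ _ → refl
    ... | w , w∈ , there (here refl) = w , w∈ , agree w

    reps-complete : ∀ n j → factor n j ∈ map (factor n) (reps n)
    reps-complete zero    j = here refl
    reps-complete (suc n) j with ∈-map⁻ (factor n) (reps-complete n j)
    ... | i , i∈ , fj≡fi with isSpecial? n i
    ...   | no ¬special = extend-survivor
      where
        same-next : Z (j + n) ≡ Z (i + n)
        same-next with Z (j + n) ≟ᴸ Z (i + n)
        ... | yes eq = eq
        ... | no neq = ⊥-elim (¬special (special-complete n i j (sym fj≡fi) λ eq → neq (sym eq)))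
        extend-survivor : factor (suc n) j ∈ map (factor (suc n)) (reps (suc n))
        extend-survivor = subst (_∈ map (factor (suc n)) (reps (suc n)))
          (Agree⇒factor-≡ (Agree-snoc (Agree-sym (factor-≡⇒Agree fj≡fi)) (sym same-next)))
          (∈-map⁺ (factor (suc n)) (∈-++⁺ˡ (∈-filter⁺ (notSpecial? n) i∈ ¬special)))
    ...   | yes special with ∈-map⁻ (λ w → factor n (bpos w)) special
    ...     | w , w∈ , fi≡fw = extend-branch (Z (j + n) ≟ᴸ a)
      where
        j~w : Agree n j (bpos w)
        j~w = factor-≡⇒Agree (trans fj≡fi fi≡fw)
        found : ∀ {k} → k ∈ occurrences w → Agree (suc n) k j → factor (suc n) j ∈ map (factor (suc n)) (reps (suc n))
        found k∈ k~j = subst (_∈ map (factor (suc n)) (reps (suc n))) (Agree⇒factor-≡ k~j)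
          (∈-map⁺ (factor (suc n)) (∈-++⁺ʳ (survivors n (reps n)) (∈-branches⁺ w∈ k∈)))
        extend-branch : Dec (Z (j + n) ≡ a) → factor (suc n) j ∈ map (factor (suc n)) (reps (suc n))
        extend-branch (yes ja) = found (there (here refl))
          (Agree-snoc (Agree-trans (agree w) (Agree-sym j~w)) (trans (a-follows w) (sym ja)))
        extend-branch (no jb) = found (here refl)
          (Agree-snoc (Agree-sym j~w) (trans (b-follows w) (sym (≢a⇒≡b jb))))

    occurrences-distinct : ∀ {n} (w : RightSpecial n) → AllPairs (Distinct (suc n)) (occurrences w)
    occurrences-distinct w = (b≢a ∷ []) ∷ [] ∷ []
      where
        b≢a : Distinct _ (bpos w) (apos w)
        b≢a eq with trans (sym (b-follows w)) (trans (Agree-last (factor-≡⇒Agree eq)) (a-follows w))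
        ... | ()

    branches-distinct : ∀ n → AllPairs (Distinct (suc n)) (branches n)
    branches-distinct n = AllPairs.concat⁺ (All.map⁺ (All.tabulate {xs = special n} λ {w} _ → occurrences-distinct w))
      (AllPairs.map⁺ {f = occurrences} (AllPairs.map (λ {w} {w′} → across {w} {w′})
        (AllPairs.map⁻ {f = λ w → factor n (bpos w)} (special-distinct n))))
      where
        occ~bpos : ∀ w → All (λ i → Agree n i (bpos w)) (occurrences w)
        occ~bpos w = (λ _ _ → refl) ∷ agree w ∷ []
        across : ∀ {w w′} → Distinct n (bpos w) (bpos w′) →
                 All (λ i → All (Distinct (suc n) i) (occurrences w′)) (occurrences w)
        across {w} {w′} w≢w′ = All.map (λ i~w → All.map (λ j~w′ → Distinct-extend i~w j~w′ w≢w′) (occ~bpos w′)) (occ~bpos w)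

    reps-distinct : ∀ n → AllPairs (Distinct n) (reps n)
    reps-distinct zero    = [] ∷ []
    reps-distinct (suc n) = AllPairs.++⁺ survivors-distinct (branches-distinct n) (All.tabulate across)
      where
        survivors-distinct : AllPairs (Distinct (suc n)) (survivors n (reps n))
        survivors-distinct = AllPairs.map (Distinct-extend (λ _ _ → refl) (λ _ _ → refl))
                                          (AllPairs.filter⁺ (notSpecial? n) (reps-distinct n))
        across : ∀ {i} → i ∈ survivors n (reps n) → All (Distinct (suc n) i) (branches n)
        across i∈ with ∈-filter⁻ (notSpecial? n) {xs = reps n} i∈
        ... | _ , ¬special = All.tabulate λ j∈ eq →
          let w , w∈ , j~w = ∈-branches⁻ j∈
          in ¬special (subst (_∈ _)
               (Agree⇒factor-≡ (Agree-sym (Agree-trans (Agree-init (factor-≡⇒Agree eq)) j~w)))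
               (∈-map⁺ (λ w → factor n (bpos w)) w∈))

    length-specialReps : ∀ n → length (filter (isSpecial? n) (reps n)) ≡ length (special n)
    length-specialReps n = begin
      length (filter (isSpecial? n) (reps n))            ≡⟨ sym (length-map (factor n) (filter (isSpecial? n) (reps n))) ⟩
      length (map (factor n) (filter (isSpecial? n) (reps n)))
        ≡⟨ ↭-length (∼bag⇒↭ (unique∧set⇒bag unique (special-distinct n) (mk⇔ to from))) ⟩
      length (words (special n))                         ≡⟨ length-map _ (special n) ⟩
      length (special n)                                 ∎
      where
        open ≡-Reasoning
        unique : Unique (map (factor n) (filter (isSpecial? n) (reps n)))
        unique = AllPairs.map⁺ (AllPairs.filter⁺ (isSpecial? n) (reps-distinct n))
        to : ∀ {u} → u ∈ map (factor n) (filter (isSpecial? n) (reps n)) → u ∈ words (special n)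
        to u∈ with ∈-map⁻ (factor n) u∈
        ... | i , i∈ , refl = proj₂ (∈-filter⁻ (isSpecial? n) {xs = reps n} i∈)
        from : ∀ {u} → u ∈ words (special n) → u ∈ map (factor n) (filter (isSpecial? n) (reps n))
        from u∈ with ∈-map⁻ (λ w → factor n (bpos w)) u∈
        ... | w , _ , refl with ∈-map⁻ (factor n) (reps-complete n (bpos w))
        ... | i , i∈ , fw≡fi = subst (_∈ map (factor n) (filter (isSpecial? n) (reps n))) (sym fw≡fi)
          (∈-map⁺ (factor n) (∈-filter⁺ (isSpecial? n) i∈ (subst (_∈ words (special n)) fw≡fi u∈)))

    length-branches : ∀ n → length (branches n) ≡ length (special n) + length (special n)
    length-branches n = go (special n)
      where
        go : ∀ ws → length (concatMap occurrences ws) ≡ length ws + length ws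
        go []       = refl
        go (w ∷ ws) = cong suc (trans (cong suc (go ws)) (sym (+-suc (length ws) (length ws))))

    length-reps : ∀ n → length (reps n) ≡ suc (specialTotal n)
    length-reps zero    = refl
    length-reps (suc n) = begin
      length (survivors n (reps n) ++ branches n)              ≡⟨ length-++ (survivors n (reps n)) ⟩
      length (survivors n (reps n)) + length (branches n)      ≡⟨ cong (length (survivors n (reps n)) +_) (length-branches n) ⟩
      length (survivors n (reps n)) + (s + s)                  ≡⟨ sym (+-assoc (length (survivors n (reps n))) s s) ⟩
      length (survivors n (reps n)) + s + s                    ≡⟨ cong (_+ s) (+-comm _ s) ⟩
      s + length (survivors n (reps n)) + s
        ≡⟨ cong (λ x → x + length (survivors n (reps n)) + s) (sym (length-specialReps n)) ⟩
      length (filter (isSpecial? n) (reps n)) + length (survivors n (reps n)) + s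
        ≡⟨ cong (_+ s) (length-filter-+-length-filter-¬ (isSpecial? n) (reps n)) ⟩
      length (reps n) + s                                      ≡⟨ cong (_+ s) (length-reps n) ⟩
      suc (specialTotal n + s)                                 ∎
      where
        open ≡-Reasoning
        s = length (special n)

module Valuation (p : ℕ) where

  q : ℕ
  q = suc (suc p)

  1<q : 1 < q
  1<q = s≤s (s≤s z≤n)

  ExactPower : ℕ → ℕ → Set
  ExactPower e N = q ^ e ∣ N × ¬ (q ^ suc e ∣ N)

  ^-monoʳ-∣ : ∀ {x y} → x ≤ y → q ^ x ∣ q ^ y
  ^-monoʳ-∣ {x} {y} x≤y =
    divides (q ^ (y ∸ x)) (trans (cong (q ^_) (sym (m∸n+n≡m x≤y))) (^-distribˡ-+-* q (y ∸ x) x))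

  n<q^n : ∀ n → n < q ^ n
  n<q^n zero    = s≤s z≤n
  n<q^n (suc n) = ≤-trans (+-mono-≤ (m^n>0 q n) (n<q^n n)) (subst (_≤ q * q ^ n) (cong (q ^ n +_) (+-identityʳ (q ^ n)))
    (*-monoˡ-≤ (q ^ n) {2} {q} (s≤s (s≤s z≤n))))

  ExactPower-unique : ∀ {e e′ N} → ExactPower e N → ExactPower e′ N → e ≡ e′
  ExactPower-unique {e} {e′} (e∣ , e+1∤) (e′∣ , e′+1∤) with <-cmp e e′
  ... | tri< e<e′ _ _ = ⊥-elim (e+1∤ (∣-trans (^-monoʳ-∣ e<e′) e′∣))
  ... | tri≈ _ e≡e′ _ = e≡e′
  ... | tri> _ _ e′<e = ⊥-elim (e′+1∤ (∣-trans (^-monoʳ-∣ e′<e) e∣))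

  opaque
    -- Fuel f ≥ N suffices: each division by q decreases N.
    νᶠ : ℕ → ℕ → ℕ
    νᶠ zero    N = 0
    νᶠ (suc f) N with q ∣? N
    ... | yes (divides c _) = suc (νᶠ f c)
    ... | no _              = 0

    ν : ℕ → ℕ
    ν N = νᶠ N N

    νᶠ-exact : ∀ f N → 0 < N → N ≤ f → ExactPower (νᶠ f N) N
    νᶠ-exact zero    N 0<N N≤0 = ⊥-elim (<⇒≱ 0<N N≤0)
    νᶠ-exact (suc f) N 0<N N≤f with q ∣? N
    ... | no q∤N = divides N (sym (*-identityʳ N)) , λ q∣N → q∤N (subst (_∣ N) (*-identityʳ q) q∣N)
    ... | yes (divides c refl) = ∣cq , ∤cq
      where
        0<c : 0 < c
        0<c = n≢0⇒n>0 λ { refl → <-irrefl refl 0<N }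
        c<cq : c < c * q
        c<cq = m<m*n c q {{>-nonZero 0<c}} 1<q
        ih : ExactPower (νᶠ f c) c
        ih = νᶠ-exact f c 0<c (≤-pred (≤-trans c<cq N≤f))
        ∣cq : q ^ suc (νᶠ f c) ∣ c * q
        ∣cq = subst (q ^ suc (νᶠ f c) ∣_) (*-comm q c) (*-monoʳ-∣ q (proj₁ ih))
        ∤cq : ¬ (q ^ suc (suc (νᶠ f c)) ∣ c * q)
        ∤cq d = proj₂ ih (*-cancelˡ-∣ q (subst (q * q ^ suc (νᶠ f c) ∣_) (*-comm c q) d))

    ν-exact : ∀ N → 0 < N → ExactPower (ν N) N
    ν-exact N 0<N = νᶠ-exact N N 0<N ≤-refl

  ExactPower⇒ν≡ : ∀ {e N} → 0 < N → ExactPower e N → ν N ≡ e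
  ExactPower⇒ν≡ 0<N = ExactPower-unique (ν-exact _ 0<N)

  ^∣⇒≤ν : ∀ {e N} → 0 < N → q ^ e ∣ N → e ≤ ν N
  ^∣⇒≤ν {e} {N} 0<N q^e∣N with e ≤? ν N
  ... | yes e≤ν = e≤ν
  ... | no e≰ν  = ⊥-elim (proj₂ (ν-exact N 0<N) (∣-trans (^-monoʳ-∣ (≰⇒> e≰ν)) q^e∣N))

  ≤ν⇒^∣ : ∀ {e N} → 0 < N → e ≤ ν N → q ^ e ∣ N
  ≤ν⇒^∣ 0<N e≤ν = ∣-trans (^-monoʳ-∣ e≤ν) (proj₁ (ν-exact _ 0<N))

  ν< : ∀ {E k} → 0 < k → k < q ^ E → ν k < E
  ν< {E} {k} 0<k k<q^E with ν k <? E
  ... | yes ν<E = ν<E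
  ... | no ν≮E  = ⊥-elim (<⇒≱ k<q^E (∣⇒≤ {{>-nonZero 0<k}} (≤ν⇒^∣ 0<k (≮⇒≥ ν≮E))))

  ν[q^k]≡k : ∀ k → ν (q ^ k) ≡ k
  ν[q^k]≡k k = ExactPower⇒ν≡ (m^n>0 q k)
    (∣-refl , λ d → <⇒≱ (^-monoʳ-< q 1<q (n<1+n k)) (∣⇒≤ {{m^n≢0 q k}} d))

  ν[d*q^t]≡t : ∀ {d t} → 0 < d → ¬ (q ∣ d) → ν (d * q ^ t) ≡ t
  ν[d*q^t]≡t {d} {t} 0<d q∤d = ExactPower⇒ν≡ (*-monoˡ-< (q ^ t) {{m^n≢0 q t}} 0<d)
    (n∣m*n d , λ q^[t+1]∣ → q∤d (*-cancelʳ-∣ (q ^ t) {{m^n≢0 q t}} q^[t+1]∣))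

  ν[N+i]≡ν[i] : ∀ {E N i} → q ^ E ∣ N → 0 < i → ν i < E → ν (N + i) ≡ ν i
  ν[N+i]≡ν[i] {E} {N} {i} q^E∣N 0<i ν<E = ExactPower⇒ν≡ (<-≤-trans 0<i (m≤n+m i N))
    ( ∣m∣n⇒∣m+n (∣-trans (^-monoʳ-∣ (<⇒≤ ν<E)) q^E∣N) (proj₁ (ν-exact i 0<i))
    , λ ∣N+i → proj₂ (ν-exact i 0<i) (∣m+n∣m⇒∣n ∣N+i (∣-trans (^-monoʳ-∣ ν<E) q^E∣N)))

  ν[N∸k]≡ν[k] : ∀ {E N k} → q ^ E ∣ N → 0 < k → k < N → ν k < E → ν (N ∸ k) ≡ ν k
  ν[N∸k]≡ν[k] {E} {N} {k} q^E∣N 0<k k<N ν<E = ExactPower⇒ν≡ (m<n⇒0<n∸m k<N)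
    ( ∣m+n∣m⇒∣n (subst (q ^ ν k ∣_) (sym k+[N∸k]≡N) (∣-trans (^-monoʳ-∣ (<⇒≤ ν<E)) q^E∣N)) (proj₁ (ν-exact k 0<k))
    , λ ∣N∸k → proj₂ (ν-exact k 0<k)
        (∣m+n∣m⇒∣n (subst (q ^ suc (ν k) ∣_) (sym (trans (+-comm (N ∸ k) k) k+[N∸k]≡N))
                               (∣-trans (^-monoʳ-∣ ν<E) q^E∣N)) ∣N∸k))
    where
      k+[N∸k]≡N : k + (N ∸ k) ≡ N
      k+[N∸k]≡N = m+[n∸m]≡n (<⇒≤ k<N)

  ν[q^t+i]≡ν[q^[t+1]+i] : ∀ t i → 0 < i → i < suc p * q ^ t → ν (q ^ t + i) ≡ ν (q ^ suc t + i)
  ν[q^t+i]≡ν[q^[t+1]+i] t i 0<i i<[q-1]q^t with ν i <? t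
  ... | yes ν<t = trans (ν[N+i]≡ν[i] {t} ∣-refl 0<i ν<t) (sym (ν[N+i]≡ν[i] {t} (n∣m*n q) 0<i ν<t))
  ... | no ν≮t with ≤ν⇒^∣ {t} 0<i (≮⇒≥ ν≮t)
  ...   | divides c refl = trans (ν[d*q^t]≡t {suc c} {t} (s≤s z≤n) q∤1+c)
                             (sym (trans (cong ν (sym (*-distribʳ-+ (q ^ t) q c)))
                                         (ν[d*q^t]≡t {q + c} {t} (<-≤-trans (s≤s z≤n) (m≤m+n q c)) q∤q+c)))
    where
      c<q-1 : c < suc p
      c<q-1 = *-cancelʳ-< (q ^ t) c (suc p) i<[q-1]q^t
      0<c : 0 < c
      0<c = n≢0⇒n>0 λ { refl → <-irrefl refl 0<i }
      q∤1+c : ¬ (q ∣ suc c)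
      q∤1+c q∣ = <⇒≱ (s≤s c<q-1) (∣⇒≤ q∣)
      q∤q+c : ¬ (q ∣ q + c)
      q∤q+c q∣ = <⇒≱ (<-trans c<q-1 (n<1+n (suc p))) (∣⇒≤ {{>-nonZero 0<c}} (∣m+n∣m⇒∣n q∣ ∣-refl))

  q∣c⇒q^[t+1]∣c*q^t : ∀ {c} t → q ∣ c → q ^ suc t ∣ c * q ^ t
  q∣c⇒q^[t+1]∣c*q^t t (divides k refl) = divides k (*-assoc k q (q ^ t))

  -- Among X, X + q^t, …, X + (q - 1) q^t one is divisible by q^(t + 1).
  ¬all-digits-exact : ∀ {X t} → q ^ t ∣ X → 0 < X → ¬ (∀ d → d < q → ν (X + d * q ^ t) ≡ t)
  ¬all-digits-exact {_} {t} (divides c refl) 0<X all-exact with c % q | m≡m%n+[m/n]*n c q | m%n<n c q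
  ... | zero  | c≡ | _   = <-irrefl (sym ν≡t) (^∣⇒≤ν 0<X (q∣c⇒q^[t+1]∣c*q^t t (divides (c / q) c≡)))
    where
      ν≡t : ν (c * q ^ t) ≡ t
      ν≡t = trans (cong ν (sym (+-identityʳ (c * q ^ t)))) (all-exact 0 (s≤s z≤n))
  ... | suc r | c≡ | r<q = <-irrefl (sym ν≡t) (^∣⇒≤ν 0<[c+d]q^t (q∣c⇒q^[t+1]∣c*q^t t q∣c+d))
    where
      d = q ∸ suc r
      d<q : d < q
      d<q = s≤s (m∸n≤m (suc p) r)
      c+d≡ : c + d ≡ suc (c / q) * q
      c+d≡ = begin
        c + d                       ≡⟨ cong (_+ d) c≡ ⟩
        suc r + c / q * q + d       ≡⟨ cong (_+ d) (+-comm (suc r) (c / q * q)) ⟩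
        c / q * q + suc r + d       ≡⟨ +-assoc (c / q * q) (suc r) d ⟩
        c / q * q + (suc r + d)     ≡⟨ cong (c / q * q +_) (m+[n∸m]≡n (<⇒≤ r<q)) ⟩
        c / q * q + q               ≡⟨ +-comm (c / q * q) q ⟩
        suc (c / q) * q             ∎
        where open ≡-Reasoning
      q∣c+d : q ∣ c + d
      q∣c+d = divides (suc (c / q)) c+d≡
      distrib : c * q ^ t + d * q ^ t ≡ (c + d) * q ^ t
      distrib = sym (*-distribʳ-+ (q ^ t) c d)
      ν≡t : ν ((c + d) * q ^ t) ≡ t
      ν≡t = trans (cong ν (sym distrib)) (all-exact d d<q)
      0<[c+d]q^t : 0 < (c + d) * q ^ t
      0<[c+d]q^t = subst (0 <_) distrib (<-≤-trans 0<X (m≤m+n _ _))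

module Ruler (p : ℕ) where

  open Valuation p

  -- z_q is the infinite product of the blocks a b^ν(M), M = 1, 2, …; prefix M is the
  -- product of the first M of them, so pos M below is the position of the (M + 1)-st a.
  block : ℕ → List Letter
  block e = a ∷ replicate e b

  prefix : ℕ → List Letter
  prefix zero    = []
  prefix (suc M) = prefix M ++ block (ν (suc M))

  repeat : ℕ → List Letter → List Letter
  repeat zero    w = []
  repeat (suc c) w = w ++ repeat c w

  repeat-suc : ∀ c w → repeat (suc c) w ≡ repeat c w ++ w
  repeat-suc zero    w = ++-identityʳ w
  repeat-suc (suc c) w = trans (cong (w ++_) (repeat-suc c w)) (sym (++-assoc w (repeat c w) w))

  h-++ : ∀ xs ys → h q (xs ++ ys) ≡ h q xs ++ h q ys
  h-++ = concatMap-++ (hLetter q)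

  h-repeat : ∀ c w → h q (repeat c w) ≡ repeat c (h q w)
  h-repeat zero    w = refl
  h-repeat (suc c) w = trans (h-++ w (repeat c w)) (cong (h q w ++_) (h-repeat c w))

  repeat-[a] : ∀ c → repeat c (a ∷ []) ≡ replicate c a
  repeat-[a] zero    = refl
  repeat-[a] (suc c) = cong (a ∷_) (repeat-[a] c)

  hIter-suc : ∀ K → hIter q (suc K) ≡ repeat q (hIter q K) ++ b ∷ []
  hIter-suc zero    = trans (++-identityʳ (replicate q a ++ b ∷ [])) (cong (_++ b ∷ []) (sym (repeat-[a] q)))
  hIter-suc (suc K) = begin
    h q (hIter q (suc K))                   ≡⟨ cong (h q) (hIter-suc K) ⟩
    h q (repeat q (hIter q K) ++ b ∷ [])    ≡⟨ h-++ (repeat q (hIter q K)) (b ∷ []) ⟩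
    h q (repeat q (hIter q K)) ++ b ∷ []    ≡⟨ cong (_++ b ∷ []) (h-repeat q (hIter q K)) ⟩
    repeat q (hIter q (suc K)) ++ b ∷ []    ∎
    where open ≡-Reasoning

  block-suc : ∀ e → block (suc e) ≡ block e ++ b ∷ []
  block-suc e = cong (a ∷_) (replicate-suc e)
    where
      replicate-suc : ∀ e → replicate (suc e) b ≡ replicate e b ++ b ∷ []
      replicate-suc zero    = refl
      replicate-suc (suc e) = cong (b ∷_) (replicate-suc e)

  prefix-+ : ∀ {E N} → q ^ E ∣ N → ∀ k → k < q ^ E → prefix (N + k) ≡ prefix N ++ prefix k
  prefix-+ {E} {N} q^E∣N zero    _        = trans (cong prefix (+-identityʳ N)) (sym (++-identityʳ (prefix N)))
  prefix-+ {E} {N} q^E∣N (suc k) 1+k<q^E = begin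
    prefix (N + suc k)                            ≡⟨ cong prefix (+-suc N k) ⟩
    prefix (N + k) ++ block (ν (suc (N + k)))     ≡⟨ cong₂ _++_ (prefix-+ {E} q^E∣N k (<-trans (n<1+n k) 1+k<q^E)) (cong block ν≡) ⟩
    (prefix N ++ prefix k) ++ block (ν (suc k))   ≡⟨ ++-assoc (prefix N) (prefix k) _ ⟩
    prefix N ++ prefix (suc k)                    ∎
    where
      open ≡-Reasoning
      ν≡ : ν (suc (N + k)) ≡ ν (suc k)
      ν≡ = trans (cong ν (sym (+-suc N k))) (ν[N+i]≡ν[i] {E} q^E∣N (s≤s z≤n) (ν< {E} (s≤s z≤n) 1+k<q^E))

  q^∸1 : ℕ → ℕ
  q^∸1 K = q ^ K ∸ 1

  suc[q^∸1] : ∀ K → suc (q^∸1 K) ≡ q ^ K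
  suc[q^∸1] K = m+[n∸m]≡n {1} (m^n>0 q K)

  prefix-q^ : ∀ K → prefix (q ^ K) ≡ prefix (q^∸1 K) ++ block K
  prefix-q^ K = begin
    prefix (q ^ K)                                   ≡⟨ cong prefix (sym (suc[q^∸1] K)) ⟩
    prefix (q^∸1 K) ++ block (ν (suc (q^∸1 K)))      ≡⟨ cong (λ x → prefix (q^∸1 K) ++ block (ν x)) (suc[q^∸1] K) ⟩
    prefix (q^∸1 K) ++ block (ν (q ^ K))             ≡⟨ cong (λ x → prefix (q^∸1 K) ++ block x) (ν[q^k]≡k K) ⟩
    prefix (q^∸1 K) ++ block K                       ∎
    where open ≡-Reasoning

  prefix-step : ∀ K c → prefix (suc c * q ^ K) ≡ (prefix (c * q ^ K) ++ prefix (q^∸1 K)) ++ block (ν (suc c * q ^ K))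
  prefix-step K c = begin
    prefix (suc c * q ^ K)                                      ≡⟨ cong prefix split ⟩
    prefix (c * q ^ K + q^∸1 K) ++ block (ν (suc (c * q ^ K + q^∸1 K)))
      ≡⟨ cong₂ _++_ (prefix-+ {K} (n∣m*n c) (q^∸1 K) (subst (q^∸1 K <_) (suc[q^∸1] K) (n<1+n _)))
                    (cong (λ x → block (ν x)) (sym split)) ⟩
    (prefix (c * q ^ K) ++ prefix (q^∸1 K)) ++ block (ν (suc c * q ^ K))  ∎
    where
      open ≡-Reasoning
      split : suc c * q ^ K ≡ suc (c * q ^ K + q^∸1 K)
      split = trans (+-comm (q ^ K) (c * q ^ K)) (trans (cong (c * q ^ K +_) (sym (suc[q^∸1] K))) (+-suc (c * q ^ K) (q^∸1 K)))

  prefix-*q^ : ∀ K c → c < q → prefix (c * q ^ K) ≡ repeat c (prefix (q ^ K))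
  prefix-*q^ K zero    _     = refl
  prefix-*q^ K (suc c) 1+c<q = begin
    prefix (suc c * q ^ K)                                          ≡⟨ prefix-step K c ⟩
    (prefix (c * q ^ K) ++ prefix (q^∸1 K)) ++ block (ν (suc c * q ^ K))
      ≡⟨ cong₂ (λ x y → (x ++ prefix (q^∸1 K)) ++ block y)
               (prefix-*q^ K c (<-trans (n<1+n c) 1+c<q)) (ν[d*q^t]≡t (s≤s z≤n) q∤1+c) ⟩
    (repeat c (prefix (q ^ K)) ++ prefix (q^∸1 K)) ++ block K       ≡⟨ ++-assoc (repeat c (prefix (q ^ K))) _ _ ⟩
    repeat c (prefix (q ^ K)) ++ (prefix (q^∸1 K) ++ block K)       ≡⟨ cong (repeat c (prefix (q ^ K)) ++_) (sym (prefix-q^ K)) ⟩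
    repeat c (prefix (q ^ K)) ++ prefix (q ^ K)                     ≡⟨ sym (repeat-suc c (prefix (q ^ K))) ⟩
    repeat (suc c) (prefix (q ^ K))                                 ∎
    where
      open ≡-Reasoning
      q∤1+c : ¬ (q ∣ suc c)
      q∤1+c q∣ = <⇒≱ 1+c<q (∣⇒≤ q∣)

  prefix-q^suc : ∀ K → prefix (q ^ suc K) ≡ repeat q (prefix (q ^ K)) ++ b ∷ []
  prefix-q^suc K = begin
    prefix (q * q ^ K)                                                         ≡⟨ prefix-step K (suc p) ⟩
    (prefix (suc p * q ^ K) ++ prefix (q^∸1 K)) ++ block (ν (q ^ suc K))
      ≡⟨ cong₂ (λ x y → (x ++ prefix (q^∸1 K)) ++ block y) (prefix-*q^ K (suc p) (n<1+n _)) (ν[q^k]≡k (suc K)) ⟩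
    (W ++ prefix (q^∸1 K)) ++ block (suc K)                                     ≡⟨ cong ((W ++ prefix (q^∸1 K)) ++_) (block-suc K) ⟩
    (W ++ prefix (q^∸1 K)) ++ (block K ++ b ∷ [])                               ≡⟨ ++-assoc W _ _ ⟩
    W ++ (prefix (q^∸1 K) ++ (block K ++ b ∷ []))                               ≡⟨ cong (W ++_) (sym (++-assoc (prefix (q^∸1 K)) (block K) _)) ⟩
    W ++ ((prefix (q^∸1 K) ++ block K) ++ b ∷ [])                               ≡⟨ cong (λ x → W ++ (x ++ b ∷ [])) (sym (prefix-q^ K)) ⟩
    W ++ (prefix (q ^ K) ++ b ∷ [])                                             ≡⟨ sym (++-assoc W _ _) ⟩
    (W ++ prefix (q ^ K)) ++ b ∷ []                                             ≡⟨ cong (_++ b ∷ []) (sym (repeat-suc (suc p) (prefix (q ^ K)))) ⟩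
    repeat q (prefix (q ^ K)) ++ b ∷ []                                         ∎
    where
      open ≡-Reasoning
      W = repeat (suc p) (prefix (q ^ K))

  hIter≡prefix : ∀ K → hIter q K ≡ prefix (q ^ K)
  hIter≡prefix zero    = cong (λ x → a ∷ replicate x b) (sym (ν[q^k]≡k 0))
  hIter≡prefix (suc K) = trans (hIter-suc K) (trans (cong (λ x → repeat q x ++ b ∷ []) (hIter≡prefix K)) (sym (prefix-q^suc K)))

  prefix-extends : ∀ M k → ∃ λ rest → prefix (M + k) ≡ prefix M ++ rest
  prefix-extends M zero    = [] , trans (cong prefix (+-identityʳ M)) (sym (++-identityʳ (prefix M)))
  prefix-extends M (suc k) with prefix-extends M k
  ... | rest , eq = rest ++ block (ν (suc (M + k))) ,
        trans (cong prefix (+-suc M k)) (trans (cong (_++ block (ν (suc (M + k)))) eq) (++-assoc (prefix M) rest _))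

  opaque
    pos : ℕ → ℕ
    pos M = length (prefix M)

    Z : ℕ → Letter
    Z = z q

    pos≡length-prefix : ∀ M → pos M ≡ length (prefix M)
    pos≡length-prefix M = refl

    Z≡z : ∀ i → Z i ≡ z q i
    Z≡z i = refl

    pos-zero : pos 0 ≡ 0
    pos-zero = refl

    pos-suc : ∀ M → pos (suc M) ≡ pos M + suc (ν (suc M))
    pos-suc M = trans (length-++ (prefix M)) (cong (λ x → pos M + suc x) (length-replicate (ν (suc M))))

    pos-<-suc : ∀ M → pos M < pos (suc M)
    pos-<-suc M = subst (pos M <_) (sym (pos-suc M)) (m<m+n (pos M) (s≤s z≤n))

    M≤pos : ∀ M → M ≤ pos M
    M≤pos zero    = z≤n
    M≤pos (suc M) = ≤-trans (s≤s (M≤pos M)) (pos-<-suc M)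

    pos-mono-< : ∀ {M M′} → M < M′ → pos M < pos M′
    pos-mono-< {M} {suc M′} (s≤s M≤M′) with m≤n⇒m<n∨m≡n M≤M′
    ... | inj₁ M<M′ = <-trans (pos-mono-< M<M′) (pos-<-suc M′)
    ... | inj₂ refl = pos-<-suc M

    pos-injective : ∀ {M M′} → pos M ≡ pos M′ → M ≡ M′
    pos-injective {M} {M′} eq with <-cmp M M′
    ... | tri< M<M′ _ _ = ⊥-elim (<-irrefl eq (pos-mono-< M<M′))
    ... | tri≈ _ M≡M′ _ = M≡M′
    ... | tri> _ _ M′<M = ⊥-elim (<-irrefl (sym eq) (pos-mono-< M′<M))

    nth-prefix-agree : ∀ M M′ i → i < pos M → i < pos M′ → nth (prefix M) i ≡ nth (prefix M′) i
    nth-prefix-agree M M′ i i<M i<M′ with ≤-total M M′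
    ... | inj₁ M≤M′ with prefix-extends M (M′ ∸ M)
    ...   | rest , eq = sym (trans (cong (λ x → nth (prefix x) i) (sym (m+[n∸m]≡n M≤M′)))
                                   (trans (cong (λ x → nth x i) eq) (nth-++ˡ (prefix M) rest i i<M)))
    nth-prefix-agree M M′ i i<M i<M′ | inj₂ M′≤M with prefix-extends M′ (M ∸ M′)
    ...   | rest , eq = trans (cong (λ x → nth (prefix x) i) (sym (m+[n∸m]≡n M′≤M)))
                              (trans (cong (λ x → nth x i) eq) (nth-++ˡ (prefix M′) rest i i<M′))

    -- z q i is read off h_q^(i+1)(a) = prefix (q ^ (i + 1)), which is long enough.
    Z≡nth-prefix : ∀ N i → i < pos N → Z i ≡ nth (prefix N) i
    Z≡nth-prefix N i i<N = trans (cong (λ x → nth x i) (hIter≡prefix (suc i)))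
      (nth-prefix-agree (q ^ suc i) N i (<-≤-trans (<-trans (n<1+n i) (n<q^n (suc i))) (M≤pos _)) i<N)

    Z[pos]≡a : ∀ M → Z (pos M) ≡ a
    Z[pos]≡a M = trans (Z≡nth-prefix (suc M) (pos M) (pos-<-suc M))
      (subst (λ x → nth (prefix M ++ block (ν (suc M))) x ≡ a) (+-identityʳ (pos M)) (nth-++ʳ (prefix M) (block (ν (suc M))) 0))

    Z-in-block≡b : ∀ M d → d < ν (suc M) → Z (pos M + suc d) ≡ b
    Z-in-block≡b M d d<ν = trans (Z≡nth-prefix (suc M) (pos M + suc d) in-block)
      (trans (nth-++ʳ (prefix M) (block (ν (suc M))) (suc d)) (nth-replicate d<ν))
      where
        in-block : pos M + suc d < pos (suc M)
        in-block = subst (pos M + suc d <_) (sym (pos-suc M)) (+-monoʳ-< (pos M) (s≤s d<ν))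
        nth-replicate : ∀ {e d} → d < e → nth (replicate e b) d ≡ b
        nth-replicate {suc e} {zero}  _         = refl
        nth-replicate {suc e} {suc d} (s≤s d<e) = nth-replicate d<e

  block-decomposition : ∀ i → ∃ λ M → ∃ λ d → d ≤ ν (suc M) × i ≡ pos M + d
  block-decomposition zero    = 0 , 0 , z≤n , sym (trans (+-identityʳ (pos 0)) pos-zero)
  block-decomposition (suc i) with block-decomposition i
  ... | M , d , d≤ν , i≡ with m≤n⇒m<n∨m≡n d≤ν
  ...   | inj₁ d<ν  = M , suc d , d<ν , trans (cong suc i≡) (sym (+-suc (pos M) d))
  ...   | inj₂ refl = suc M , 0 , z≤n ,
          trans (cong suc i≡) (trans (sym (+-suc (pos M) d)) (trans (sym (pos-suc M)) (sym (+-identityʳ _))))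

  Z≡a⇒pos : ∀ i → Z i ≡ a → ∃ λ M → i ≡ pos M
  Z≡a⇒pos i Zi≡a with block-decomposition i
  ... | M , zero  , _   , i≡ = M , trans i≡ (+-identityʳ (pos M))
  ... | M , suc d , d<ν , i≡ with trans (sym (Z-in-block≡b M d d<ν)) (trans (cong Z (sym i≡)) Zi≡a)
  ...   | ()

module Blocks (p : ℕ) where

  open Valuation p
  open Ruler p

  Agree≤ : (L i j : ℕ) → Set
  Agree≤ L i j = ∀ d → d ≤ L → Z (i + d) ≡ Z (j + d)

  SameBlocks : (J x y : ℕ) → Set
  SameBlocks J x y = ∀ j → j < J → ν (suc (x + j)) ≡ ν (suc (y + j))

  pos-+suc : ∀ {w j L} → pos (w + j) ≡ pos w + L → pos (w + suc j) ≡ pos w + (L + suc (ν (suc (w + j))))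
  pos-+suc {w} {j} {L} w-end = begin
    pos (w + suc j)                      ≡⟨ cong pos (+-suc w j) ⟩
    pos (suc (w + j))                    ≡⟨ pos-suc (w + j) ⟩
    pos (w + j) + suc (ν (suc (w + j)))  ≡⟨ cong (_+ suc (ν (suc (w + j)))) w-end ⟩
    pos w + L + suc (ν (suc (w + j)))    ≡⟨ +-assoc (pos w) L _ ⟩
    pos w + (L + suc (ν (suc (w + j))))  ∎
    where open ≡-Reasoning

  pos-+-mono : ∀ w j → pos (w + j) ≤ pos (w + suc j)
  pos-+-mono w j = <⇒≤ (pos-mono-< (subst (w + j <_) (sym (+-suc w j)) (n<1+n _)))

  SameBlocks⇒Agree≤ : ∀ x y J → SameBlocks J x y →
    ∃ λ L → pos (x + J) ≡ pos x + L × pos (y + J) ≡ pos y + L × Agree≤ L (pos x) (pos y)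
  SameBlocks⇒Agree≤ x y zero _ = 0 , at x , at y , λ { zero _ → trans (cong Z (+-identityʳ (pos x)))
                                     (trans (Z[pos]≡a x) (sym (trans (cong Z (+-identityʳ (pos y))) (Z[pos]≡a y)))) }
    where
      at : ∀ w → pos (w + 0) ≡ pos w + 0
      at w = trans (cong pos (+-identityʳ w)) (sym (+-identityʳ (pos w)))
  SameBlocks⇒Agree≤ x y (suc J) same with SameBlocks⇒Agree≤ x y J (λ j j<J → same j (m<n⇒m<1+n j<J))
  ... | L , x-end , y-end , agree = L + suc e , at x x-end refl , at y y-end (sym (same J (n<1+n J))) , agree′
    where
      e = ν (suc (x + J))
      at : ∀ w → pos (w + J) ≡ pos w + L → ν (suc (w + J)) ≡ e → pos (w + suc J) ≡ pos w + (L + suc e)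
      at w w-end ν≡e = trans (pos-+suc w-end) (cong (λ m → pos w + (L + suc m)) ν≡e)
      inside : ∀ w k → pos w + (L + k) ≡ pos w + L + k
      inside w k = sym (+-assoc (pos w) L k)
      agree′ : Agree≤ (L + suc e) (pos x) (pos y)
      agree′ d d≤ with ≤-+-cases L (suc e) d d≤
      ... | inj₁ d≤L = agree d d≤L
      ... | inj₂ (k , k<1+e , refl) with m≤n⇒m<n∨m≡n (≤-pred k<1+e)
      ...   | inj₁ k<e = trans (cong Z (trans (inside x (suc k)) (cong (_+ suc k) (sym x-end))))
                          (trans (Z-in-block≡b (x + J) k k<e)
                          (sym (trans (cong Z (trans (inside y (suc k)) (cong (_+ suc k) (sym y-end))))
                                      (Z-in-block≡b (y + J) k (subst (k <_) (same J (n<1+n J)) k<e)))))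
      ...   | inj₂ refl = trans (cong Z (sym (trans (cong pos (sym (+-suc x J))) (at x x-end refl))))
                          (trans (Z[pos]≡a (suc (x + J)))
                          (sym (trans (cong Z (sym (trans (cong pos (sym (+-suc y J))) (at y y-end (sym (same J (n<1+n J)))))))
                                      (Z[pos]≡a (suc (y + J))))))

  Agree≤-sym : ∀ {L i j} → Agree≤ L i j → Agree≤ L j i
  Agree≤-sym agree d d≤L = sym (agree d d≤L)

  Agree≤⇒Z≡a : ∀ {L S y} → Agree≤ L S (pos y) → Z S ≡ a
  Agree≤⇒Z≡a {L} {S} {y} agree = trans (cong Z (sym (+-identityʳ S)))
    (trans (agree 0 z≤n) (trans (cong Z (+-identityʳ (pos y))) (Z[pos]≡a y)))

  -- At the end of the shorter block of b's, one word reads a and the other b.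
  block-lengths-differ : ∀ {x y j L₀ L} → pos (x + j) ≡ pos x + L₀ → pos (y + j) ≡ pos y + L₀ →
    Agree≤ L (pos x) (pos y) → L₀ + suc (ν (suc (x + j))) ≤ L → ¬ ν (suc (x + j)) < ν (suc (y + j))
  block-lengths-differ {x} {y} {j} {L₀} x-end y-end agree d≤L νx<νy with
    trans (sym (Z[pos]≡a (suc (x + j)))) (trans (cong Z x-side) (trans (agree d d≤L) (trans (cong Z y-side)
      (Z-in-block≡b (y + j) (ν (suc (x + j))) νx<νy))))
    where
      d = L₀ + suc (ν (suc (x + j)))
      x-side : pos (suc (x + j)) ≡ pos x + d
      x-side = trans (cong pos (sym (+-suc x j))) (pos-+suc x-end)
      y-side : pos y + d ≡ pos (y + j) + suc (ν (suc (x + j)))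
      y-side = trans (sym (+-assoc (pos y) L₀ _)) (cong (_+ suc (ν (suc (x + j)))) (sym y-end))
  ... | ()

  Agree≤⇒SameBlocks : ∀ x y L J → Agree≤ L (pos x) (pos y) → pos (x + J) ≤ pos x + L → SameBlocks J x y
  Agree≤⇒SameBlocks x y L (suc J) agree bound j j<1+J with m≤n⇒m<n∨m≡n (≤-pred j<1+J)
  ... | inj₁ j<J  = Agree≤⇒SameBlocks x y L J agree (≤-trans (pos-+-mono x J) bound) j j<J
  ... | inj₂ refl with SameBlocks⇒Agree≤ x y j (Agree≤⇒SameBlocks x y L j agree (≤-trans (pos-+-mono x j) bound))
  ...   | L₀ , x-end , y-end , _ with <-cmp (ν (suc (x + j))) (ν (suc (y + j)))
  ...     | tri≈ _ νx≡νy _ = νx≡νy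
  ...     | tri< νx<νy _ _ = ⊥-elim (block-lengths-differ x-end y-end agree x-bound νx<νy)
    where
      x-bound : L₀ + suc (ν (suc (x + j))) ≤ L
      x-bound = +-cancelˡ-≤ (pos x) _ L (subst (_≤ pos x + L) (pos-+suc x-end) bound)
  ...     | tri> _ _ νy<νx = ⊥-elim (block-lengths-differ y-end x-end (Agree≤-sym agree) y-bound νy<νx)
    where
      y-bound : L₀ + suc (ν (suc (y + j))) ≤ L
      y-bound = ≤-trans (+-monoʳ-≤ L₀ (<⇒≤ (s≤s νy<νx)))
                  (+-cancelˡ-≤ (pos x) _ L (subst (_≤ pos x + L) (pos-+suc x-end) bound))

  b-run⇒≤ν : ∀ M s → (∀ j → j < s → Z (pos M + suc j) ≡ b) → s ≤ ν (suc M)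
  b-run⇒≤ν M s run with s ≤? ν (suc M)
  ... | yes s≤ν = s≤ν
  ... | no s≰ν with trans (sym (Z[pos]≡a (suc M))) (trans (cong Z (pos-suc M)) (run (ν (suc M)) (≰⇒> s≰ν)))
  ...   | ()

  b-run-then-a⇒ν≡ : ∀ M t → (∀ j → j < t → Z (pos M + suc j) ≡ b) → Z (pos M + suc t) ≡ a → ν (suc M) ≡ t
  b-run-then-a⇒ν≡ M t run then-a with m≤n⇒m<n∨m≡n (b-run⇒≤ν M t run)
  ... | inj₂ t≡ν = sym t≡ν
  ... | inj₁ t<ν with trans (sym (Z-in-block≡b M t t<ν)) then-a
  ...   | ()

module SelfSimilarity (p : ℕ) where

  open Valuation p
  open Ruler p
  open Blocks p
  open FactorsOf Z using (Agree)

  -- For level t: pos (y₀ t) and pos (m₀ t) are the a's starting the last blocks (of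
  -- lengths t and t + 1) of h^t(a) and h^(t+1)(a); ℓ t = |h^t(a)|, and E t = (q - 1) ℓ t
  -- is the distance between these two a's.
  y₀ m₀ : ℕ → ℕ
  y₀ t = q^∸1 t
  m₀ t = q^∸1 (suc t)

  ℓ E : ℕ → ℕ
  ℓ t = pos (q ^ t)
  E t = suc p * ℓ t

  suc[y₀] : ∀ t → suc (y₀ t) ≡ q ^ t
  suc[y₀] = suc[q^∸1]

  suc[m₀] : ∀ t → suc (m₀ t) ≡ q ^ suc t
  suc[m₀] t = suc[q^∸1] (suc t)

  ν[suc[y₀]] : ∀ t → ν (suc (y₀ t)) ≡ t
  ν[suc[y₀]] t = trans (cong ν (suc[y₀] t)) (ν[q^k]≡k t)

  ν[suc[m₀]] : ∀ t → ν (suc (m₀ t)) ≡ suc t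
  ν[suc[m₀]] t = trans (cong ν (suc[m₀] t)) (ν[q^k]≡k (suc t))

  ℓ≡pos[y₀]+suc : ∀ t → ℓ t ≡ pos (y₀ t) + suc t
  ℓ≡pos[y₀]+suc t = trans (pos≡length-prefix _) (trans (cong length (prefix-q^ t))
    (trans (length-++ (prefix (y₀ t))) (cong₂ (λ y x → y + suc x) (sym (pos≡length-prefix (y₀ t))) (length-replicate t))))

  ℓ-suc : ∀ t → ℓ (suc t) ≡ q * ℓ t + 1
  ℓ-suc t = trans (pos≡length-prefix _) (trans (cong length (prefix-q^suc t))
    (trans (length-++ (repeat q (prefix (q ^ t)))) (cong (_+ 1) (trans (length-repeat q (prefix (q ^ t)))
      (cong (q *_) (sym (pos≡length-prefix (q ^ t))))))))
    where
      length-repeat : ∀ c w → length (repeat c w) ≡ c * length w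
      length-repeat zero    w = refl
      length-repeat (suc c) w = trans (length-++ w) (cong (length w +_) (length-repeat c w))

  suc[E]≡q^suc : ∀ t → suc (E t) ≡ q ^ suc t
  suc[E]≡q^suc zero    = cong (λ x → suc (suc p * x)) (trans (ℓ≡pos[y₀]+suc 0) (cong (_+ 1) pos-zero))
  suc[E]≡q^suc (suc t) = trans (cong (λ x → suc (suc p * x)) (ℓ-suc t)) (trans (identity p (ℓ t)) (cong (q *_) (suc[E]≡q^suc t)))
    where
      identity : ∀ p l → suc (suc p * (suc (suc p) * l + 1)) ≡ suc (suc p) * suc (suc p * l)
      identity = solve-∀

  pos[y₀]+E≡pos[m₀] : ∀ t → pos (y₀ t) + E t ≡ pos (m₀ t)
  pos[y₀]+E≡pos[m₀] t = +-cancelʳ-≡ (suc (suc t)) _ _ (trans via-y₀ (sym via-m₀))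
    where
      via-m₀ : pos (m₀ t) + suc (suc t) ≡ q * ℓ t + 1
      via-m₀ = trans (sym (ℓ≡pos[y₀]+suc (suc t))) (ℓ-suc t)
      identity : ∀ p y t → suc (suc p) * (y + suc t) + 1 ≡ y + suc p * (y + suc t) + suc (suc t)
      identity = solve-∀
      via-y₀ : pos (y₀ t) + E t + suc (suc t) ≡ q * ℓ t + 1
      via-y₀ = trans (cong (λ x → pos (y₀ t) + suc p * x + suc (suc t)) (ℓ≡pos[y₀]+suc t))
                (trans (sym (identity p (pos (y₀ t)) t)) (cong (λ x → q * x + 1) (sym (ℓ≡pos[y₀]+suc t))))

  m₀≤M : ∀ {t M} → q ^ suc t ∣ suc M → m₀ t ≤ M
  m₀≤M {t} {M} q^[t+1]∣ = ≤-pred (subst (_≤ suc M) (sym (suc[m₀] t)) (∣⇒≤ q^[t+1]∣))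

  -- ν(M + 1 − k) = ν k = ν(q^(t+1) − k) for 0 < k < q^(t+1)
  SameBlocks-before-multiple : ∀ t M → q ^ suc t ∣ suc M → SameBlocks (m₀ t) (M ∸ m₀ t) 0
  SameBlocks-before-multiple t M q^[t+1]∣ j j<m₀ =
    trans (cong ν x-side) (trans (ν[N∸k]≡ν[k] {suc t} q^[t+1]∣ 0<k (<-≤-trans k<q^[t+1] (∣⇒≤ q^[t+1]∣)) ν[k]<)
    (sym (trans (cong ν 0-side) (ν[N∸k]≡ν[k] {suc t} ∣-refl 0<k k<q^[t+1] ν[k]<))))
    where
      x = M ∸ m₀ t
      k = m₀ t ∸ j
      j+k≡m₀ : j + k ≡ m₀ t
      j+k≡m₀ = m+[n∸m]≡n (<⇒≤ j<m₀)
      0<k : 0 < k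
      0<k = m<n⇒0<n∸m j<m₀
      k<q^[t+1] : k < q ^ suc t
      k<q^[t+1] = subst (k <_) (suc[m₀] t) (s≤s (m∸n≤m (m₀ t) j))
      ν[k]< : ν k < suc t
      ν[k]< = ν< 0<k k<q^[t+1]
      M≡ : M ≡ x + j + k
      M≡ = trans (sym (m∸n+n≡m (m₀≤M {t} q^[t+1]∣))) (trans (cong (x +_) (sym j+k≡m₀)) (sym (+-assoc x j k)))
      x-side : suc (x + j) ≡ suc M ∸ k
      x-side = sym (trans (cong (λ w → suc w ∸ k) M≡) (m+n∸n≡m (suc (x + j)) k))
      0-side : suc (0 + j) ≡ q ^ suc t ∸ k
      0-side = sym (trans (cong (_∸ k) (trans (sym (suc[m₀] t)) (cong suc (sym j+k≡m₀)))) (m+n∸n≡m (suc j) k))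

  prefix-reoccurs : ∀ t M → q ^ suc t ∣ suc M → ∃ λ X → pos M ≡ X + pos (m₀ t) × Agree≤ (pos (m₀ t)) X 0
  prefix-reoccurs t M q^[t+1]∣ with SameBlocks⇒Agree≤ (M ∸ m₀ t) 0 (m₀ t) (SameBlocks-before-multiple t M q^[t+1]∣)
  ... | L , x-end , 0-end , agree = pos (M ∸ m₀ t) , pos-M ,
      λ d d≤ → trans (agree d (subst (d ≤_) pos[m₀]≡L d≤)) (cong (λ w → Z (w + d)) pos-zero)
    where
      pos[m₀]≡L : pos (m₀ t) ≡ L
      pos[m₀]≡L = trans 0-end (cong (_+ L) pos-zero)
      pos-M : pos M ≡ pos (M ∸ m₀ t) + pos (m₀ t)
      pos-M = trans (cong pos (sym (m∸n+n≡m (m₀≤M {t} q^[t+1]∣)))) (trans x-end (cong (pos (M ∸ m₀ t) +_) (sym pos[m₀]≡L)))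

  K : ℕ → ℕ
  K t = suc p * q ^ t

  y₀+K≡m₀ : ∀ t → y₀ t + K t ≡ m₀ t
  y₀+K≡m₀ t = suc-injective (trans (cong (_+ K t) (suc[y₀] t)) (sym (suc[m₀] t)))

  copy⇒SameBlocks : ∀ t x → Agree≤ (E t) (pos x) (pos (y₀ t)) → SameBlocks (K t) (y₀ t) x
  copy⇒SameBlocks t x agree = Agree≤⇒SameBlocks (y₀ t) x (E t) (K t) (Agree≤-sym agree)
    (≤-reflexive (trans (cong pos (y₀+K≡m₀ t)) (sym (pos[y₀]+E≡pos[m₀] t))))

  -- A copy of the word from pos (y₀ t) to pos (m₀ t) starts at some a, say at pos x, and
  -- the K t blocks after it have the lengths of those after y₀ t; so all q numbers
  -- x + 1 + d q^t (d < q) would have valuation exactly t.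
  copy-ends-before-block≢t : ∀ t M S → S + E t ≡ pos M → Agree≤ (E t) S (pos (y₀ t)) → ν (suc M) ≢ t
  copy-ends-before-block≢t t M S S+E≡pos[M] agree ν≡t with Z≡a⇒pos S (Agree≤⇒Z≡a agree)
  ... | x , refl with SameBlocks⇒Agree≤ x (y₀ t) (K t) (λ j j<K → sym (copy⇒SameBlocks t x agree j j<K))
  ...   | L , x-end , y₀-end , _ = ¬all-digits-exact (≤ν⇒^∣ (s≤s z≤n) (≤-reflexive (sym ν[suc[x]]≡t))) (s≤s z≤n) digit-exact
    where
      L≡E : L ≡ E t
      L≡E = +-cancelˡ-≡ (pos (y₀ t)) _ _ (trans (sym y₀-end) (trans (cong pos (y₀+K≡m₀ t)) (sym (pos[y₀]+E≡pos[m₀] t))))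
      x+K≡M : x + K t ≡ M
      x+K≡M = pos-injective (trans x-end (trans (cong (pos x +_) L≡E) S+E≡pos[M]))
      digit-exact : ∀ d → d < q → ν (suc x + d * q ^ t) ≡ t
      digit-exact d d<q with m≤n⇒m<n∨m≡n (≤-pred d<q)
      ... | inj₁ d<q-1 = trans (sym (copy⇒SameBlocks t x agree (d * q ^ t) (*-monoˡ-< (q ^ t) {{m^n≢0 q t}} d<q-1)))
                           (trans (cong ν (cong (_+ d * q ^ t) (suc[y₀] t))) (ν[d*q^t]≡t (s≤s z≤n) q∤1+d))
        where
          q∤1+d : ¬ (q ∣ suc d)
          q∤1+d q∣ = <⇒≱ (s≤s d<q-1) (∣⇒≤ q∣)
      ... | inj₂ refl = trans (cong (λ w → ν (suc w)) x+K≡M) ν≡t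
      ν[suc[x]]≡t : ν (suc x) ≡ t
      ν[suc[x]]≡t = trans (cong ν (sym (+-identityʳ (suc x)))) (digit-exact 0 (s≤s z≤n))

  J : ℕ → ℕ
  J t = y₀ t + p * q ^ t

  K≡suc[J] : ∀ t → K t ≡ suc (J t)
  K≡suc[J] t = cong (_+ p * q ^ t) (sym (suc[y₀] t))

  suc[y₀]+J≡m₀ : ∀ t → suc (y₀ t) + J t ≡ m₀ t
  suc[y₀]+J≡m₀ t = trans (sym (+-suc (y₀ t) (J t))) (trans (cong (y₀ t +_) (sym (K≡suc[J] t))) (y₀+K≡m₀ t))

  -- suc (m₂ t) = (2q − 1) q^t
  m₂ : ℕ → ℕ
  m₂ t = suc (m₀ t) + J t

  ν[suc[m₂]] : ∀ t → ν (suc (m₂ t)) ≡ t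
  ν[suc[m₂]] t = trans (cong ν suc[m₂]≡) (ν[d*q^t]≡t (s≤s z≤n) q∤q+q-1)
    where
      suc[m₂]≡ : suc (m₂ t) ≡ (q + suc p) * q ^ t
      suc[m₂]≡ = trans (sym (+-suc (suc (m₀ t)) (J t)))
                   (trans (cong₂ _+_ (suc[m₀] t) (sym (K≡suc[J] t))) (sym (*-distribʳ-+ (q ^ t) q (suc p))))
      q∤q+q-1 : ¬ (q ∣ q + suc p)
      q∤q+q-1 q∣ = <⇒≱ (n<1+n (suc p)) (∣⇒≤ (∣m+n∣m⇒∣n q∣ ∣-refl))

  SameBlocks-y₀-m₀ : ∀ t → SameBlocks (J t) (suc (y₀ t)) (suc (m₀ t))
  SameBlocks-y₀-m₀ t j j<J = trans (cong ν y₀-side) (trans (ν[q^t+i]≡ν[q^[t+1]+i] t (suc j) (s≤s z≤n) 1+j<K) (sym (cong ν m₀-side)))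
    where
      y₀-side : suc (suc (y₀ t) + j) ≡ q ^ t + suc j
      y₀-side = trans (sym (+-suc (suc (y₀ t)) j)) (cong (_+ suc j) (suc[y₀] t))
      m₀-side : suc (suc (m₀ t) + j) ≡ q ^ suc t + suc j
      m₀-side = trans (sym (+-suc (suc (m₀ t)) j)) (cong (_+ suc j) (suc[m₀] t))
      1+j<K : suc j < K t
      1+j<K = subst (suc j <_) (sym (K≡suc[J] t)) (s≤s j<J)

  c₀ c₂ : ℕ → ℕ
  c₀ t = suc (pos (y₀ t))
  c₂ t = suc (suc (pos (m₀ t)))

  pos[suc[y₀]]≡c₀+t : ∀ t → pos (suc (y₀ t)) ≡ c₀ t + t
  pos[suc[y₀]]≡c₀+t t = trans (pos-suc (y₀ t)) (trans (cong (λ x → pos (y₀ t) + suc x) (ν[suc[y₀]] t)) (+-suc (pos (y₀ t)) t))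

  pos[suc[m₀]]≡c₂+t : ∀ t → pos (suc (m₀ t)) ≡ c₂ t + t
  pos[suc[m₀]]≡c₂+t t = trans (pos-suc (m₀ t)) (trans (cong (λ x → pos (m₀ t) + suc x) (ν[suc[m₀]] t))
    (trans (+-suc (pos (m₀ t)) (suc t)) (cong suc (+-suc (pos (m₀ t)) t))))

  c₀+[E+t]≡pos[m₀]+suc : ∀ t → c₀ t + (E t + t) ≡ pos (m₀ t) + suc t
  c₀+[E+t]≡pos[m₀]+suc t = trans (cong suc (sym (+-assoc (pos (y₀ t)) (E t) t)))
    (trans (cong (λ x → suc (x + t)) (pos[y₀]+E≡pos[m₀] t)) (sym (+-suc (pos (m₀ t)) t)))

  windows-agree : ∀ t → Agree (E t + t) (c₀ t) (c₂ t) × c₂ t + (E t + t) ≡ pos (suc (m₂ t))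
  windows-agree t with SameBlocks⇒Agree≤ (suc (y₀ t)) (suc (m₀ t)) (J t) (SameBlocks-y₀-m₀ t)
  ... | L , y₀-end , m₀-end , agree = agree′ , end
    where
      pos[m₀]≡ : pos (m₀ t) ≡ c₀ t + t + L
      pos[m₀]≡ = trans (cong pos (sym (suc[y₀]+J≡m₀ t))) (trans y₀-end (cong (_+ L) (pos[suc[y₀]]≡c₀+t t)))
      pos[m₂]≡ : pos (m₂ t) ≡ c₂ t + t + L
      pos[m₂]≡ = trans m₀-end (cong (_+ L) (pos[suc[m₀]]≡c₂+t t))
      E≡ : E t ≡ suc (t + L)
      E≡ = +-cancelˡ-≡ (pos (y₀ t)) _ _ (trans (pos[y₀]+E≡pos[m₀] t)
             (trans pos[m₀]≡ (trans (+-assoc (c₀ t) t L) (sym (+-suc (pos (y₀ t)) (t + L))))))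
      end : c₂ t + (E t + t) ≡ pos (suc (m₂ t))
      end = sym (begin
        pos (suc (m₂ t))                  ≡⟨ pos-suc (m₂ t) ⟩
        pos (m₂ t) + suc (ν (suc (m₂ t))) ≡⟨ cong₂ (λ x y → x + suc y) pos[m₂]≡ (ν[suc[m₂]] t) ⟩
        c₂ t + t + L + suc t              ≡⟨ rearrange (c₂ t) t L ⟩
        c₂ t + (suc (t + L) + t)          ≡⟨ cong (λ x → c₂ t + (x + t)) (sym E≡) ⟩
        c₂ t + (E t + t)                  ∎)
        where
          open ≡-Reasoning
          rearrange : ∀ c t L → c + t + L + suc t ≡ c + (suc (t + L) + t)
          rearrange = solve-∀
      shifted : ∀ c d′ → c + (t + d′) ≡ c + t + d′
      shifted c d′ = sym (+-assoc c t d′)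
      in-last-blocks : ∀ k → k < t → Z (c₀ t + (t + (L + suc k))) ≡ Z (c₂ t + (t + (L + suc k)))
      in-last-blocks k k<t = trans (cong Z (y₀-way)) (trans (Z-in-block≡b (m₀ t) k (subst (k <_) (sym (ν[suc[m₀]] t)) (m<n⇒m<1+n k<t)))
                               (sym (trans (cong Z m₂-way) (Z-in-block≡b (m₂ t) k (subst (k <_) (sym (ν[suc[m₂]] t)) k<t)))))
        where
          y₀-way : c₀ t + (t + (L + suc k)) ≡ pos (m₀ t) + suc k
          y₀-way = trans (shifted (c₀ t) (L + suc k)) (trans (sym (+-assoc (c₀ t + t) L (suc k))) (cong (_+ suc k) (sym pos[m₀]≡)))
          m₂-way : c₂ t + (t + (L + suc k)) ≡ pos (m₂ t) + suc k
          m₂-way = trans (shifted (c₂ t) (L + suc k)) (trans (sym (+-assoc (c₂ t + t) L (suc k))) (cong (_+ suc k) (sym pos[m₂]≡)))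
      in-first-blocks : ∀ d → d < t → Z (c₀ t + d) ≡ Z (c₂ t + d)
      in-first-blocks d d<t =
        trans (cong Z (sym (+-suc (pos (y₀ t)) d))) (trans (Z-in-block≡b (y₀ t) d (subst (d <_) (sym (ν[suc[y₀]] t)) d<t))
        (sym (trans (cong Z (trans (cong suc (sym (+-suc (pos (m₀ t)) d))) (sym (+-suc (pos (m₀ t)) (suc d)))))
                    (Z-in-block≡b (m₀ t) (suc d) (subst (suc d <_) (sym (ν[suc[m₀]] t)) (s≤s d<t))))))
      agree′ : Agree (E t + t) (c₀ t) (c₂ t)
      agree′ d d<E+t with ≤-<-connex t d
      ... | inj₂ d<t = in-first-blocks d d<t
      ... | inj₁ t≤d with m+[n∸m]≡n t≤d
      ...   | t+d′≡d with ≤-+-cases L t (d ∸ t) (+-cancelˡ-≤ t (d ∸ t) (L + t) (subst (_≤ t + (L + t)) (sym t+d′≡d) d≤))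
        where
          d≤ : d ≤ t + (L + t)
          d≤ = ≤-pred (subst (d <_) (trans (cong (_+ t) E≡) (cong suc (+-assoc t L t))) d<E+t)
      ...     | inj₁ d′≤L = subst (λ x → Z (c₀ t + x) ≡ Z (c₂ t + x)) t+d′≡d
                  (trans (cong Z (trans (shifted (c₀ t) (d ∸ t)) (cong (_+ (d ∸ t)) (sym (pos[suc[y₀]]≡c₀+t t)))))
                  (trans (agree (d ∸ t) d′≤L) (cong Z (trans (cong (_+ (d ∸ t)) (pos[suc[m₀]]≡c₂+t t)) (sym (shifted (c₂ t) (d ∸ t)))))))
      ...     | inj₂ (k , k<t , d′≡) = subst (λ x → Z (c₀ t + x) ≡ Z (c₂ t + x)) (trans (cong (t +_) (sym d′≡)) t+d′≡d)
                  (in-last-blocks k k<t)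

module RightSpecialFactors (p : ℕ) where

  open Valuation p
  open Ruler p
  open Blocks p
  open SelfSimilarity p
  open FactorsOf Z

  valid? : ∀ n t → Dec (n ∸ t + 1 ≤ q ^ suc t)
  valid? n t = n ∸ t + 1 ≤? q ^ suc t

  levels : ℕ → List ℕ
  levels n = filter (valid? n) (upTo (suc n))

  levels-bounds : ∀ {n t} → t ∈ levels n → t ≤ n × n ≤ E t + t
  levels-bounds {n} {t} t∈ with ∈-filter⁻ (valid? n) {xs = upTo (suc n)} t∈
  ... | t∈upTo , valid = t≤n , subst (_≤ E t + t) (m∸n+n≡m t≤n) (+-monoˡ-≤ t n∸t≤E)
    where
      t≤n : t ≤ n
      t≤n = ≤-pred (∈-upTo⁻ t∈upTo)
      n∸t≤E : n ∸ t ≤ E t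
      n∸t≤E = ≤-pred (subst₂ _≤_ (+-comm (n ∸ t) 1) (sym (suc[E]≡q^suc t)) valid)

  ∈-levels⁺ : ∀ {n t} → t ≤ n → n ∸ t + 1 ≤ q ^ suc t → t ∈ levels n
  ∈-levels⁺ {n} t≤n valid = ∈-filter⁺ (valid? n) (∈-upTo⁺ (s≤s t≤n)) valid

  -- For t ≤ n ≤ E t + t, the factor of length n ending with the a at pos (m₀ t) followed
  -- by t b's is right special: here it is followed by the last b of that block, and at
  -- rapos t n, given by windows-agree, by the a at pos (suc (m₂ t)).
  rpos rapos : ℕ → ℕ → ℕ
  rpos  t n = c₀ t + (E t + t ∸ n)
  rapos t n = c₂ t + (E t + t ∸ n)

  [c+[L∸n]]+n≡c+L : ∀ c {L n} → n ≤ L → c + (L ∸ n) + n ≡ c + L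
  [c+[L∸n]]+n≡c+L c {L} {n} n≤L = trans (+-assoc c (L ∸ n) n) (cong (c +_) (m∸n+n≡m n≤L))

  rpos+n : ∀ {n t} → n ≤ E t + t → rpos t n + n ≡ pos (m₀ t) + suc t
  rpos+n {t = t} n≤ = trans ([c+[L∸n]]+n≡c+L (c₀ t) n≤) (c₀+[E+t]≡pos[m₀]+suc t)

  rapos+n : ∀ {n t} → n ≤ E t + t → rapos t n + n ≡ pos (suc (m₂ t))
  rapos+n {t = t} n≤ = trans ([c+[L∸n]]+n≡c+L (c₂ t) n≤) (proj₂ (windows-agree t))

  rightSpecialAt : ∀ {n t} → n ≤ E t + t → RightSpecial n
  rightSpecialAt {n} {t} n≤ = record
    { bpos      = rpos t n
    ; apos      = rapos t n
    ; b-follows = trans (cong Z (rpos+n n≤)) (Z-in-block≡b (m₀ t) t (subst (t <_) (sym (ν[suc[m₀]] t)) (n<1+n t)))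
    ; a-follows = trans (cong Z (rapos+n n≤)) (Z[pos]≡a (suc (m₂ t)))
    ; agree     = λ k k<n → trans (cong Z (+-assoc (c₂ t) _ k))
        (trans (sym (proj₁ (windows-agree t) (E t + t ∸ n + k) (subst (E t + t ∸ n + k <_) (m∸n+n≡m n≤) (+-monoʳ-< _ k<n))))
               (cong Z (sym (+-assoc (c₀ t) _ k))))
    }

  rpos-tail-b : ∀ {n t} → n ≤ E t + t → t ≤ n → ∀ k → k < t → Z (rpos t n + (n ∸ t + k)) ≡ b
  rpos-tail-b {n} {t} n≤ t≤n k k<t = trans (cong Z shift) (Z-in-block≡b (m₀ t) k (subst (k <_) (sym (ν[suc[m₀]] t)) (m<n⇒m<1+n k<t)))
    where
      rpos+[n∸t]≡ : rpos t n + (n ∸ t) ≡ suc (pos (m₀ t))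
      rpos+[n∸t]≡ = +-cancelʳ-≡ t _ _ (trans (+-assoc (rpos t n) (n ∸ t) t)
                     (trans (cong (rpos t n +_) (m∸n+n≡m t≤n)) (trans (rpos+n n≤) (+-suc (pos (m₀ t)) t))))
      shift : rpos t n + (n ∸ t + k) ≡ pos (m₀ t) + suc k
      shift = trans (sym (+-assoc (rpos t n) (n ∸ t) k)) (trans (cong (_+ k) rpos+[n∸t]≡) (sym (+-suc (pos (m₀ t)) k)))

  rpos-tail-a : ∀ {n t} → n ≤ E t + t → t < n → Z (rpos t n + (n ∸ suc t)) ≡ a
  rpos-tail-a {n} {t} n≤ t<n = trans (cong Z rpos+[n∸1+t]≡) (Z[pos]≡a (m₀ t))
    where
      rpos+[n∸1+t]≡ : rpos t n + (n ∸ suc t) ≡ pos (m₀ t)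
      rpos+[n∸1+t]≡ = +-cancelʳ-≡ (suc t) _ _ (trans (+-assoc (rpos t n) (n ∸ suc t) (suc t))
                        (trans (cong (rpos t n +_) (m∸n+n≡m t<n)) (rpos+n n≤)))

  -- In the factor of level t′ the letter at n − t − 1 is a b, in that of level t it is an a.
  levels-distinct : ∀ {n t t′} → t < t′ → t ∈ levels n → t′ ∈ levels n → Distinct n (rpos t n) (rpos t′ n)
  levels-distinct {n} {t} {t′} t<t′ t∈ t′∈ eq with
    trans (sym (rpos-tail-a (proj₂ (levels-bounds t∈)) t<n))
      (trans (factor-≡⇒Agree eq (n ∸ suc t) n∸1+t<n)
        (trans (cong (λ x → Z (rpos t′ n + x)) (sym n∸t′+k≡)) (rpos-tail-b (proj₂ (levels-bounds t′∈)) t′≤n k k<t′)))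
    where
      t′≤n : t′ ≤ n
      t′≤n = proj₁ (levels-bounds t′∈)
      t<n : t < n
      t<n = <-≤-trans t<t′ t′≤n
      k = n ∸ suc t ∸ (n ∸ t′)
      n∸t′+k≡ : n ∸ t′ + k ≡ n ∸ suc t
      n∸t′+k≡ = m+[n∸m]≡n (∸-monoʳ-≤ n t<t′)
      n∸1+t<n : n ∸ suc t < n
      n∸1+t<n = ∸-monoʳ-< {n} {suc t} {0} (s≤s z≤n) t<n
      k<t′ : k < t′
      k<t′ = +-cancelˡ-< (n ∸ t′) k t′ (subst₂ _<_ (sym n∸t′+k≡) (sym (m∸n+n≡m t′≤n)) n∸1+t<n)
  ... | ()

  +-shift : ∀ {x m P} k → x + m ≡ P → P + suc k ≡ x + (suc m + k)
  +-shift {x} {m} k x+m≡P = trans (cong (_+ suc k) (sym x+m≡P)) (trans (+-assoc x m (suc k)) (cong (x +_) (+-suc m k)))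

  a-then-exact-run : ∀ {i m t} → Z (i + m) ≡ a → BRun i m t → Z (i + (suc m + t)) ≡ a →
    ∃ λ M → i + m ≡ pos M × ν (suc M) ≡ t
  a-then-exact-run {i} {m} {t} Z≡a run then-a with Z≡a⇒pos (i + m) Z≡a
  ... | M , i+m≡ = M , i+m≡ , b-run-then-a⇒ν≡ M t (λ k k<t → trans (cong Z (+-shift k i+m≡)) (run k k<t))
                                                  (trans (cong Z (+-shift t i+m≡)) then-a)

  a-then-long-run : ∀ {j m t} → Z (j + m) ≡ a → BRun j m (suc t) →
    ∃ λ X → j + m ≡ X + pos (m₀ t) × Agree≤ (pos (m₀ t)) X 0
  a-then-long-run {j} {m} {t} Z≡a run with Z≡a⇒pos (j + m) Z≡a
  ... | M , j+m≡
      with prefix-reoccurs t M (≤ν⇒^∣ (s≤s z≤n) (b-run⇒≤ν M (suc t) λ k k<1+t → trans (cong Z (+-shift k j+m≡)) (run k k<1+t)))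
  ...   | X , pos[M]≡ , copy = X , trans j+m≡ pos[M]≡ , copy

  window-in-prefix-copy : ∀ {n i j m t X P s m′} → Agree n i j → m < n → j + m ≡ X + pos (m₀ t) →
    Agree≤ (pos (m₀ t)) X 0 → P + m′ ≡ pos (m₀ t) → s + m′ ≡ m → Agree≤ m′ (i + s) P
  window-in-prefix-copy {n} {i} {j} {m} {t} {X} {P} {s} {m′} agree m<n j+m≡ copy P+m′≡ s+m′≡m d d≤m′ = begin
    Z (i + s + d)       ≡⟨ cong Z (+-assoc i s d) ⟩
    Z (i + (s + d))     ≡⟨ agree (s + d) (≤-<-trans (subst (s + d ≤_) s+m′≡m (+-monoʳ-≤ s d≤m′)) m<n) ⟩
    Z (j + (s + d))     ≡⟨ cong Z j+[s+d]≡ ⟩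
    Z (X + (P + d))     ≡⟨ copy (P + d) (subst (P + d ≤_) P+m′≡ (+-monoʳ-≤ P d≤m′)) ⟩
    Z (P + d)           ∎
    where
      open ≡-Reasoning
      j+s≡X+P : j + s ≡ X + P
      j+s≡X+P = +-cancelʳ-≡ m′ _ _ (begin
        j + s + m′       ≡⟨ +-assoc j s m′ ⟩
        j + (s + m′)     ≡⟨ cong (j +_) s+m′≡m ⟩
        j + m            ≡⟨ j+m≡ ⟩
        X + pos (m₀ t)   ≡⟨ cong (X +_) (sym P+m′≡) ⟩
        X + (P + m′)     ≡⟨ sym (+-assoc X P m′) ⟩
        X + P + m′       ∎)
      j+[s+d]≡ : j + (s + d) ≡ X + (P + d)
      j+[s+d]≡ = trans (sym (+-assoc j s d)) (trans (cong (_+ d) j+s≡X+P) (+-assoc X P d))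

  BRun-transfer : ∀ {i j m t} → Agree (suc m + t) i j → BRun i m t → Z (j + (suc m + t)) ≡ b → BRun j m (suc t)
  BRun-transfer {m = m} agree run j-b k k<1+t =
    case-< k<1+t (λ k<t → trans (sym (agree (suc m + k) (+-monoʳ-< (suc m) k<t))) (run k k<t)) j-b

  agrees-with-level : ∀ {i j m t X} → Agree (suc m + t) i j → BRun i m t → j + m ≡ X + pos (m₀ t) →
    Agree≤ (pos (m₀ t)) X 0 → suc m + t ≤ E t + t → Agree (suc m + t) i (rpos t (suc m + t))
  agrees-with-level {i} {j} {m} {t} agree run j+m≡ copy n≤ k k<n with ≤-+-cases m t k (≤-pred k<n)
  ... | inj₁ k≤m = trans (cong (λ x → Z (x + k)) (sym (+-identityʳ i)))
                     (window-in-prefix-copy {t = t} agree (s≤s (m≤m+n m t)) j+m≡ copy rpos+m≡ refl k k≤m)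
    where
      rpos+m≡ : rpos t (suc m + t) + m ≡ pos (m₀ t)
      rpos+m≡ = +-cancelʳ-≡ (suc t) _ _ (trans (+-assoc (rpos t (suc m + t)) m (suc t))
                  (trans (cong (rpos t (suc m + t) +_) (+-suc m t)) (rpos+n {t = t} n≤)))
  ... | inj₂ (k′ , k′<t , refl) = trans (cong (λ x → Z (i + x)) (+-suc m k′)) (trans (run k′ k′<t)
      (sym (trans (cong (λ x → Z (rpos t (suc m + t) + x)) (trans (+-suc m k′) (cong (_+ k′) (sym (m+n∸n≡m (suc m) t)))))
                  (rpos-tail-b {t = t} n≤ (m≤n+m t (suc m)) k′ k′<t))))

  long-window-impossible : ∀ {n i j m t X M} → Agree n i j → m < n → j + m ≡ X + pos (m₀ t) →
    Agree≤ (pos (m₀ t)) X 0 → i + m ≡ pos M → ν (suc M) ≡ t → ¬ E t ≤ m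
  long-window-impossible {i = i} {m = m} {t} {M = M} agree m<n j+m≡ copy i+m≡ ν≡t E≤m =
    copy-ends-before-block≢t t M (i + (m ∸ E t)) S+E≡
      (window-in-prefix-copy {t = t} agree m<n j+m≡ copy (pos[y₀]+E≡pos[m₀] t) (m∸n+n≡m E≤m)) ν≡t
    where
      S+E≡ : i + (m ∸ E t) + E t ≡ pos M
      S+E≡ = trans (+-assoc i (m ∸ E t) (E t)) (trans (cong (i +_) (m∸n+n≡m E≤m)) i+m≡)

  invalid⇒E≤m : ∀ {m t} → ¬ (suc m + t ∸ t + 1 ≤ q ^ suc t) → E t ≤ m
  invalid⇒E≤m {m} {t} invalid = ≤-pred (≤-pred (subst₂ _≤_ (cong suc (sym (suc[E]≡q^suc t)))
    (trans (cong (_+ 1) (m+n∸n≡m (suc m) t)) (+-comm (suc m) 1)) (≰⇒> invalid)))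

  right-special⇒level : ∀ n i j → Agree n i j → Z (i + n) ≡ a → Z (j + n) ≡ b → ∃ λ t → t ∈ levels n × Agree n i (rpos t n)
  right-special⇒level n i j agree i-a j-b with lastA n i
  ... | no-a all-b = n , ∈-levels⁺ ≤-refl n-valid , λ k k<n → trans (all-b k k<n)
          (sym (trans (cong (λ x → Z (rpos n n + x)) (cong (_+ k) (sym (n∸n≡0 n)))) (rpos-tail-b (m≤n+m n (E n)) ≤-refl k k<n)))
    where
      n-valid : n ∸ n + 1 ≤ q ^ suc n
      n-valid = subst (λ x → x + 1 ≤ q ^ suc n) (sym (n∸n≡0 n)) (m^n>0 q (suc n))
  ... | last-a m t refl Z≡a run
      with a-then-exact-run Z≡a run i-a | a-then-long-run (trans (sym (agree m (s≤s (m≤m+n m t)))) Z≡a) (BRun-transfer agree run j-b)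
  ...   | M , i+m≡ , ν≡t | X , j+m≡ , copy with valid? (suc m + t) t
  ...     | yes valid = t , t∈ , agrees-with-level agree run j+m≡ copy (proj₂ (levels-bounds t∈))
    where
      t∈ : t ∈ levels (suc m + t)
      t∈ = ∈-levels⁺ (m≤n+m t (suc m)) valid
  ...     | no invalid = ⊥-elim (long-window-impossible agree (s≤s (m≤m+n m t)) j+m≡ copy i+m≡ ν≡t (invalid⇒E≤m {m} {t} invalid))

  special : (n : ℕ) → List (RightSpecial n)
  special n = mapWith∈ (levels n) (λ t∈ → rightSpecialAt (proj₂ (levels-bounds t∈)))

  words-special : ∀ n → words (special n) ≡ map (λ t → factor n (rpos t n)) (levels n)
  words-special n = trans (map-mapWith∈ (levels n) _ _) (mapWith∈≗map (λ t → factor n (rpos t n)) (levels n))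

  length-special : ∀ n → length (special n) ≡ length (levels n)
  length-special n = trans (sym (length-map _ (special n)))
    (trans (cong length (words-special n)) (length-map _ (levels n)))

  special-distinct : ∀ n → Unique (words (special n))
  special-distinct n = subst Unique (sym (words-special n)) (AllPairs.map⁺
    (AllPairs-restrict (λ t∈ t′∈ t<t′ → levels-distinct t<t′ t∈ t′∈) (All.tabulate λ t∈ → t∈)
      (AllPairs.filter⁺ (valid? n) (AllPairs.applyUpTo⁺₁ (λ t → t) (suc n) λ t<t′ _ → t<t′))))

  at-level : ∀ {n i} → ∃ (λ t → t ∈ levels n × Agree n i (rpos t n)) → factor n i ∈ words (special n)
  at-level {n} (t , t∈ , agree) = subst (_∈ words (special n)) (sym (Agree⇒factor-≡ agree))
    (subst (factor n (rpos t n) ∈_) (sym (words-special n)) (∈-map⁺ (λ t → factor n (rpos t n)) t∈))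

  special-complete : ∀ n i j → factor n i ≡ factor n j → Z (i + n) ≢ Z (j + n) → factor n i ∈ words (special n)
  special-complete n i j fi≡fj Zi≢Zj with Z (i + n) ≟ᴸ a | Z (j + n) ≟ᴸ a
  ... | yes i-a | _       = at-level
      (right-special⇒level n i j (factor-≡⇒Agree fi≡fj) i-a (≢a⇒≡b λ j-a → Zi≢Zj (trans i-a (sym j-a))))
  ... | no i≢a  | yes j-a = subst (_∈ words (special n)) (sym fi≡fj)
      (at-level (right-special⇒level n j i (factor-≡⇒Agree (sym fi≡fj)) j-a (≢a⇒≡b i≢a)))
  ... | no i≢a  | no j≢a  = ⊥-elim (Zi≢Zj (trans (≢a⇒≡b i≢a) (sym (≢a⇒≡b j≢a))))

module FormulaRecurrence (p : ℕ) where

  open Valuation p using (q)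
  open RightSpecialFactors p using (levels; valid?)

  term : ℕ → ℕ → ℕ
  term n i = q ^ i ⊓ (n ∸ i + 1)

  formula≡∑< : ∀ n → formula q n ≡ ∑< (suc n) (term n)
  formula≡∑< n = cong sum (map-applyUpTo (λ i → i) (term n) (suc n))

  new : ℕ → ℕ → ℕ
  new n i = 𝟙 (suc (n ∸ i + 1) ≤? q ^ i)

  term-suc : ∀ n i → i < suc n → term (suc n) i ≡ term n i + new n i
  term-suc n i i≤n = trans (cong (λ x → q ^ i ⊓ (x + 1)) (+-∸-assoc 1 (≤-pred i≤n))) (⊓-suc (q ^ i) (n ∸ i + 1))

  -- reindexing i = t + 1; the term i = 0 vanishes and the term t = n is 1
  ∑<-new : ∀ n → ∑< (suc n) (new n) + 1 ≡ ∑< (suc n) (λ t → 𝟙 (valid? n t))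
  ∑<-new n = begin
    new n 0 + ∑< n (new n ∘ suc) + 1
      ≡⟨ cong (λ x → x + ∑< n (new n ∘ suc) + 1) (𝟙-no (suc (n ∸ 0 + 1) ≤? 1) λ { (s≤s n+1≤0) → n+1≰0 n+1≤0 }) ⟩
    ∑< n (new n ∘ suc) + 1
      ≡⟨ cong (_+ 1) (∑<-cong n λ t t<n → cong (λ x → 𝟙 (x ≤? q ^ suc t)) (cong (_+ 1) (sym (+-∸-assoc 1 t<n)))) ⟩
    ∑< n (λ t → 𝟙 (valid? n t)) + 1      ≡⟨ cong (∑< n (λ t → 𝟙 (valid? n t)) +_) (sym (𝟙-yes (valid? n n) n-valid)) ⟩
    ∑< n (λ t → 𝟙 (valid? n t)) + 𝟙 (valid? n n) ≡⟨ sym (∑<-suc n _) ⟩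
    ∑< (suc n) (λ t → 𝟙 (valid? n t))    ∎
    where
      open ≡-Reasoning
      n+1≰0 : ∀ {n} → ¬ n + 1 ≤ 0
      n+1≰0 {zero} ()
      n+1≰0 {suc n} ()
      n-valid : n ∸ n + 1 ≤ q ^ suc n
      n-valid = subst (λ x → x + 1 ≤ q ^ suc n) (sym (n∸n≡0 n)) (m^n>0 q (suc n))

  formula-suc : ∀ n → formula q (suc n) ≡ formula q n + length (levels n)
  formula-suc n = begin
    formula q (suc n)                                              ≡⟨ formula≡∑< (suc n) ⟩
    ∑< (suc (suc n)) (term (suc n))                                ≡⟨ ∑<-suc (suc n) (term (suc n)) ⟩
    ∑< (suc n) (term (suc n)) + term (suc n) (suc n)               ≡⟨ cong₂ _+_ (∑<-cong (suc n) (term-suc n)) last-term ⟩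
    ∑< (suc n) (λ i → term n i + new n i) + 1                      ≡⟨ cong (_+ 1) (∑<-+ (suc n) (term n) (new n)) ⟩
    ∑< (suc n) (term n) + ∑< (suc n) (new n) + 1                   ≡⟨ +-assoc (∑< (suc n) (term n)) _ 1 ⟩
    ∑< (suc n) (term n) + (∑< (suc n) (new n) + 1)                 ≡⟨ cong₂ _+_ (sym (formula≡∑< n)) (∑<-new n) ⟩
    formula q n + ∑< (suc n) (λ t → 𝟙 (valid? n t))
      ≡⟨ cong (formula q n +_) (sym (length-filter-applyUpTo (valid? n) (suc n) (λ t → t))) ⟩
    formula q n + length (levels n)                                ∎
    where
      open ≡-Reasoning
      last-term : term (suc n) (suc n) ≡ 1
      last-term = trans (cong (λ x → q ^ suc n ⊓ (x + 1)) (n∸n≡0 n)) (m≥n⇒m⊓n≡n (m^n>0 q (suc n)))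

module FactorComplexity (p : ℕ) where

  open Valuation p using (q)
  open Ruler p using (Z; Z≡z)
  open FactorsOf Z using (factor; module Counting)
  open RightSpecialFactors p using (special; special-distinct; special-complete; length-special)
  open Counting special special-distinct special-complete
  open FormulaRecurrence p using (formula-suc)

  suc[specialTotal]≡formula : ∀ n → suc (specialTotal n) ≡ formula q n
  suc[specialTotal]≡formula zero    = refl
  suc[specialTotal]≡formula (suc n) = trans (cong (λ x → suc (specialTotal n + x)) (length-special n))
    (trans (cong (_+ length (RightSpecialFactors.levels p n)) (suc[specialTotal]≡formula n)) (sym (formula-suc n)))

  factor≡factorAt : ∀ n i → factor n i ≡ factorAt q n i
  factor≡factorAt n i = tabulate-cong λ k → Z≡z _

  factorCount : ∀ n → FactorCount q n (formula q n)
  factorCount n = L , subst Unique (map-cong (factor≡factorAt n) (reps n)) (AllPairs.map⁺ (reps-distinct n))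
                    , trans (length-map (factorAt q n) (reps n)) (trans (length-reps n) (suc[specialTotal]≡formula n))
                    , λ u → (λ u∈ → let i , _ , u≡ = ∈-map⁻ (factorAt q n) u∈ in i , sym u≡)
                          , λ { (i , refl) → subst (_∈ L) (factor≡factorAt n i)
                                 (subst (factor n i ∈_) (map-cong (factor≡factorAt n) (reps n)) (reps-complete n i)) }
    where
      L = map (factorAt q n) (reps n)

theorem17 : (q : ℕ) → 2 ≤ q → (n : ℕ) → FactorCount q n (formula q n)
theorem17 (suc (suc p)) (s≤s (s≤s z≤n)) = FactorComplexity.factorCount p
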